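{- Let $k\ge 3$, $b_k=2(k-2)$, let $\overline{c}=(c_1,\dots,c_{b_k})$ be a balanced 2-flat sequence of integers from $[0,2^{k-1}-1]$ and let $s=height(\overline{c})$. For $i=1,\dots,5k-12$ let $f_i=Q^k_{((i-1)\bmod 3)+1}$ and $f=f_{5k-12}\circ f_{5k-13}\circ\dots\circ f_1$. Then $f(\overline{c})=(\tfrac s2)^{b_k}$ if $s$ is even, and $f(\overline{c})=(\tfrac{s-1}2)^{k-2}\oplus(\tfrac{s+1}2)^{k-2}$ otherwise (where $a^n$ denotes the constant sequence of length $n$ and $\oplus$ concatenation).
   Context: Let $h_i=2^{k-i-1}-1$. For $\overline{c}\in\mathbb{R}^{b_k}$ and $1\le i\le k-2$ (unmentioned entries unchanged): $cyc^k(\overline{c})$ has entry $1$ equal to $\max(c_1,c_{b_k}-1)$, entry $b_k$ equal to $\min(c_1+1,c_{b_k})$; $dec^k_i(\overline{c})$ has entry $i$ equal to $\min(c_i,c_{b_k-i+1}+h_i)$, entry $b_k-i+1$ equal to $\max(c_i-h_i,c_{b_k-i+1})$; $mov^k_i(\overline{c})$ has entry $t$ equal to $\min(c_t,c_{t+1})$ for $t\in\{i,b_k-i\}$ and $\max(c_{t-1},c_t)$ for $t\in\{i+1,b_k-i+1\}$. $args(cyc^k)=\{1,b_k\}$, $args(dec^k_i)=\{i,b_k-i+1\}$, $args(mov^k_i)=\{i,i+1,b_k-i,b_k-i+1\}$. With $i\in\{1,\dots,k-2\}$: $Q^k_1=\{cyc^k\}\cup\{dec^k_i:i\equiv2\}\cup\{mov^k_i:i\equiv0\}$,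 $Q^k_2=\{dec^k_i:i\equiv1\}\cup\{mov^k_i:i\equiv2\}$, $Q^k_3=\{dec^k_i:i\equiv0\}\cup\{mov^k_i:i\equiv1\}$ (mod 3). Within each $Q^k_r$ the sets $args(f)$ are pairwise disjoint and $Q^k_r$ also denotes the map with $(Q^k_r(\overline{c}))_t=(f(\overline{c}))_t$ if $t\in args(f)$ for some $f\in Q^k_r$, and $=c_t$ otherwise. A sequence $(c_1,\dots,c_{2m})$ is flat if $c_1\le\dots\le c_{2m}\le c_1+1$; 2-flat if $(c_1,c_3,\dots,c_{2m-1})$ and $(c_2,c_4,\dots,c_{2m})$ are flat; balanced if $c_i+c_{2m-i+1}=c_1+c_{2m}$ for $i=2,\dots,m$, with height $c_1+c_{2m}$. -}

module Defs where

open import Data.Nat as ℕ using (ℕ; zero; suc; _∸_; _^_; _%_; _≡ᵇ_)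
open import Data.Integer as ℤ using (ℤ; +_; _⊔_; _⊓_)
open import Data.Product using (_×_)
open import Data.Bool using (Bool; true; false; if_then_else_; _∨_)
open import Data.List using (List; []; _∷_; _++_; map; upTo; filterᵇ)
open import Data.Bool.ListAction using (any)
open import Relation.Binary.PropositionalEquality using (_≡_)

-- A (finite) sequence (c_1,...,c_n) of integers is represented 1-indexed
-- as a function ℕ → ℤ; only positions 1..n are meaningful.
Seq : Set
Seq = ℕ → ℤ

b : ℕ → ℕ
b k = 2 ℕ.* (k ∸ 2)

h : ℕ → ℕ → ℤ
h k i = + (2 ^ (k ∸ i ∸ 1)) ℤ.- + 1

cyc : ℕ → Seq → Seq
cyc k c t =
  if t ≡ᵇ 1 then c 1 ⊔ (c (b k) ℤ.- + 1)
  else if t ≡ᵇ b k then (c 1 ℤ.+ + 1) ⊓ c (b k)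
  else c t

dec : ℕ → ℕ → Seq → Seq
dec k i c t =
  let j = b k ∸ i ℕ.+ 1 in
  if t ≡ᵇ i then c i ⊓ (c j ℤ.+ h k i)
  else if t ≡ᵇ j then (c i ℤ.- h k i) ⊔ c j
  else c t

mov : ℕ → ℕ → Seq → Seq
mov k i c t =
  let j = b k ∸ i in
  if t ≡ᵇ i then c i ⊓ c (suc i)
  else if t ≡ᵇ j then c j ⊓ c (suc j)
  else if t ≡ᵇ suc i then c i ⊔ c (suc i)
  else if t ≡ᵇ suc j then c j ⊔ c (suc j)
  else c t

record Op : Set where
  constructor op
  field
    args : List ℕ
    app  : Seq → Seq

cycOp : ℕ → Op
cycOp k = op (1 ∷ b k ∷ []) (cyc k)

decOp : ℕ → ℕ → Op
decOp k i = op (i ∷ (b k ∸ i ℕ.+ 1) ∷ []) (dec k i)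

movOp : ℕ → ℕ → Op
movOp k i = op (i ∷ suc i ∷ (b k ∸ i) ∷ suc (b k ∸ i) ∷ []) (mov k i)

idx : ℕ → ℕ → List ℕ
idx k r = filterᵇ (λ i → i % 3 ≡ᵇ r) (map suc (upTo (k ∸ 2)))

Qset : ℕ → ℕ → List Op
Qset k 1 = cycOp k ∷ (map (decOp k) (idx k 2) ++ map (movOp k) (idx k 0))
Qset k 2 = map (decOp k) (idx k 1) ++ map (movOp k) (idx k 2)
Qset k 3 = map (decOp k) (idx k 0) ++ map (movOp k) (idx k 1)
Qset k _ = []

-- the map induced by a family with pairwise disjoint argument sets:
-- entry t is f(c)_t if t ∈ args(f) for some f in the family, else c_t
applyFamily : List Op → Seq → Seq
applyFamily [] c t = c t
applyFamily (op as f ∷ fs) c t =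
  if any (λ a → a ≡ᵇ t) as then f c t else applyFamily fs c t

Q : ℕ → ℕ → Seq → Seq
Q k r = applyFamily (Qset k r)

steps : ℕ → ℕ → ℕ → Seq → Seq
steps k j zero    c = c
steps k j (suc n) c = steps k (suc j) n (Q k (((j ∸ 1) % 3) ℕ.+ 1) c)

F : ℕ → Seq → Seq
F k = steps k 1 (5 ℕ.* k ∸ 12)

Flat : ℕ → Seq → Set
Flat n d = (∀ t → 1 ℕ.≤ t → t ℕ.< n → d t ℤ.≤ d (suc t))
         × (1 ℕ.≤ n → d n ℤ.≤ d 1 ℤ.+ + 1)

TwoFlat : ℕ → Seq → Set
TwoFlat m c = Flat m (λ t → c (2 ℕ.* t ∸ 1)) × Flat m (λ t → c (2 ℕ.* t))

Balanced : ℕ → Seq → Set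
Balanced m c = ∀ i → 2 ℕ.≤ i → i ℕ.≤ m →
  c i ℤ.+ c (2 ℕ.* m ∸ i ℕ.+ 1) ≡ c 1 ℤ.+ c (2 ℕ.* m)

height : ℕ → Seq → ℤ
height m c = c 1 ℤ.+ c (2 ℕ.* m)

module Submission where

-- Positions i and b_k + 1 - i (1 ≤ i ≤ k - 2) form mirror pairs, and every operation maps the two entries
-- of a pair to entries of pairs: dec_i and cyc act inside pair i resp. pair 1, and mov_i replaces pairs i and
-- i + 1 by their componentwise minimum and maximum (mov_{k-2} sorts pair k - 2). Balancedness says that all
-- pairs have the same sum s, and this is preserved, since min/max of two pairs with equal sums again have that
-- sum. So a pair is described by its difference d = c_i - c_{b_k+1-i}, on which dec_i acts as
-- d ↦ min(d, 2h_i - d), cyc as d ↦ max(d, -2 - d), mov_{k-2} as d ↦ min(d, -d) and mov_i as min/max of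
-- neighbouring differences; in round t pair i is moved by the operation selected by (i + t) mod 3.
-- By induction on t, every difference stays within an explicit envelope: an upper bound 2^e - 1 and possibly
-- the lower bound -1. Once 2i + 3(k - 2) ≤ t + 2 the envelope is -1 ≤ d ≤ 0, which holds for all pairs after
-- 5k - 12 rounds, and a pair with sum s and difference -1 or 0 is (s/2, s/2) or ((s-1)/2, (s+1)/2).

open import Data.Nat using (ℕ)

module Residues where

  open import Data.Nat using (ℕ; zero; suc; _+_; _*_; _%_)
  import Data.Nat.Properties as NP
  open import Data.Nat.DivMod using ([m+n]%n≡m%n)
  open import Data.Nat.Tactic.RingSolver using (solve-∀)
  open import Relation.Binary.PropositionalEquality

  mod3 : ℕ → ℕ
  mod3 0 = 0
  mod3 1 = 1
  mod3 2 = 2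
  mod3 (suc (suc (suc n))) = mod3 n

  data Residue : ℕ → Set where
    0₃ : Residue 0
    1₃ : Residue 1
    2₃ : Residue 2

  residue : ∀ n → Residue (mod3 n)
  residue 0 = 0₃
  residue 1 = 1₃
  residue 2 = 2₃
  residue (suc (suc (suc n))) = residue n

  %3≡mod3 : ∀ n → n % 3 ≡ mod3 n
  %3≡mod3 0 = refl
  %3≡mod3 1 = refl
  %3≡mod3 2 = refl
  %3≡mod3 (suc (suc (suc n))) =
    trans (trans (cong (_% 3) (NP.+-comm 3 n)) ([m+n]%n≡m%n n 3)) (%3≡mod3 n)

  succ3 : ℕ → ℕ
  succ3 0 = 1
  succ3 1 = 2
  succ3 _ = 0

  mod3-suc : ∀ n → mod3 (suc n) ≡ succ3 (mod3 n)
  mod3-suc 0 = refl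
  mod3-suc 1 = refl
  mod3-suc 2 = refl
  mod3-suc (suc (suc (suc n))) = mod3-suc n

  mod3-suc-≡ : ∀ n {r} → mod3 n ≡ r → mod3 (suc n) ≡ succ3 r
  mod3-suc-≡ n e = trans (mod3-suc n) (cong succ3 e)

  mod3-+suc-≡ : ∀ i t {r} → mod3 (i + t) ≡ r → mod3 (i + suc t) ≡ succ3 r
  mod3-+suc-≡ i t e = trans (cong mod3 (NP.+-suc i t)) (mod3-suc-≡ (i + t) e)

  mod3-+ʳ : ∀ a b → mod3 (a + b) ≡ mod3 (a + mod3 b)
  mod3-+ʳ a 0 = refl
  mod3-+ʳ a 1 = refl
  mod3-+ʳ a 2 = refl
  mod3-+ʳ a (suc (suc (suc b))) = begin
    mod3 (a + (3 + b))   ≡⟨ cong mod3 (NP.+-comm a (3 + b)) ⟩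
    mod3 (b + a)         ≡⟨ cong mod3 (NP.+-comm b a) ⟩
    mod3 (a + b)         ≡⟨ mod3-+ʳ a b ⟩
    mod3 (a + mod3 b)    ∎
    where open ≡-Reasoning

  mod3-+ʳ-≡ : ∀ r t {ρ} → mod3 t ≡ ρ → mod3 (r + t) ≡ mod3 (r + ρ)
  mod3-+ʳ-≡ r t e = trans (mod3-+ʳ r t) (cong (λ y → mod3 (r + y)) e)

  mod3-+ˡ : ∀ a b → mod3 (a + b) ≡ mod3 (mod3 a + b)
  mod3-+ˡ a b = begin
    mod3 (a + b)        ≡⟨ cong mod3 (NP.+-comm a b) ⟩
    mod3 (b + a)        ≡⟨ mod3-+ʳ b a ⟩
    mod3 (b + mod3 a)   ≡⟨ cong mod3 (NP.+-comm b (mod3 a)) ⟩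
    mod3 (mod3 a + b)   ∎
    where open ≡-Reasoning

  mod3-+3* : ∀ n a → mod3 (n + 3 * a) ≡ mod3 n
  mod3-+3* n a =
    trans (mod3-+ʳ n (3 * a)) (trans (cong (λ r → mod3 (n + r)) (mod3-3* a)) (cong mod3 (NP.+-identityʳ n)))
    where
    mod3-3* : ∀ a → mod3 (3 * a) ≡ 0
    mod3-3* zero = refl
    mod3-3* (suc a) = trans (cong mod3 (NP.*-suc 3 a)) (mod3-3* a)

  mod3-+-cancelʳ : ∀ a a' t → mod3 (a + t) ≡ mod3 (a' + t) → mod3 a ≡ mod3 a'
  mod3-+-cancelʳ a a' t e = begin
    mod3 a                         ≡⟨ via a ⟩
    mod3 (mod3 (a + t) + 2 * t)    ≡⟨ cong (λ r → mod3 (r + 2 * t)) e ⟩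
    mod3 (mod3 (a' + t) + 2 * t)   ≡⟨ sym (via a') ⟩
    mod3 a'                        ∎
    where
    open ≡-Reasoning
    regroup : ∀ x t → x + 3 * t ≡ (x + t) + 2 * t
    regroup = solve-∀
    via : ∀ x → mod3 x ≡ mod3 (mod3 (x + t) + 2 * t)
    via x = begin
      mod3 x                        ≡⟨ sym (mod3-+3* x t) ⟩
      mod3 (x + 3 * t)              ≡⟨ cong mod3 (regroup x t) ⟩
      mod3 ((x + t) + 2 * t)        ≡⟨ mod3-+ˡ (x + t) (2 * t) ⟩
      mod3 (mod3 (x + t) + 2 * t)   ∎

  mod3-suc≡1 : ∀ n → mod3 (suc n) ≡ 1 → mod3 n ≡ 0
  mod3-suc≡1 n e with mod3 n | residue n | mod3-suc n
  ... | .0 | 0₃ | _ = refl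
  ... | .1 | 1₃ | e' with () ← trans (sym e) e'
  ... | .2 | 2₃ | e' with () ← trans (sym e) e'

  mod3-2+≡0 : ∀ n → mod3 (suc (suc n)) ≡ 0 → mod3 n ≡ 1
  mod3-2+≡0 n e with mod3 n | residue n | mod3-suc (suc n) | mod3-suc n
  ... | .0 | 0₃ | e₁ | e₂ with () ← trans (sym e) (trans e₁ (cong succ3 e₂))
  ... | .1 | 1₃ | _ | _ = refl
  ... | .2 | 2₃ | e₁ | e₂ with () ← trans (sym e) (trans e₁ (cong succ3 e₂))

module Families where

  open import Defs
  open import Data.Nat using (ℕ; zero; suc; _≡ᵇ_; _≤ᵇ_; _≤_)
  import Data.Nat.Properties as NP
  open import Data.Bool using (Bool; true; false; T)
  import Data.Bool.Properties as BP
  open import Data.Bool.ListAction using (any)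
  open import Data.List using (List; _∷_)
  open import Data.List.Membership.Propositional using (_∈_)
  open import Data.List.Relation.Unary.Any using (here; there)
  open import Data.Empty using (⊥-elim)
  open import Relation.Nullary using (¬_)
  open import Relation.Binary.PropositionalEquality
  open import Function using (_∘′_)

  ≡ᵇ-refl : ∀ n → (n ≡ᵇ n) ≡ true
  ≡ᵇ-refl zero = refl
  ≡ᵇ-refl (suc n) = ≡ᵇ-refl n

  ≡⇒≡ᵇ-true : ∀ {a b} → a ≡ b → (a ≡ᵇ b) ≡ true
  ≡⇒≡ᵇ-true {a} refl = ≡ᵇ-refl a

  ≡ᵇ-true⇒≡ : ∀ {a b} → (a ≡ᵇ b) ≡ true → a ≡ b
  ≡ᵇ-true⇒≡ {a} {b} eq = NP.≡ᵇ⇒≡ a b (subst T (sym eq) _)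

  ≢⇒≡ᵇ-false : ∀ {a b} → ¬ a ≡ b → (a ≡ᵇ b) ≡ false
  ≢⇒≡ᵇ-false {a} {b} a≢b with a ≡ᵇ b in eq
  ... | false = refl
  ... | true = ⊥-elim (a≢b (≡ᵇ-true⇒≡ eq))

  ≤⇒≤ᵇ-true : ∀ {a b} → a ≤ b → (a ≤ᵇ b) ≡ true
  ≤⇒≤ᵇ-true {a} {b} a≤b with a ≤ᵇ b in eq
  ... | true = refl
  ... | false = ⊥-elim (subst T eq (NP.≤⇒≤ᵇ a≤b))

  ≤ᵇ-true⇒≤ : ∀ {a b} → (a ≤ᵇ b) ≡ true → a ≤ b
  ≤ᵇ-true⇒≤ {a} {b} eq = NP.≤ᵇ⇒≤ a b (subst T (sym eq) _)

  ≰⇒≤ᵇ-false : ∀ {a b} → ¬ a ≤ b → (a ≤ᵇ b) ≡ false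
  ≰⇒≤ᵇ-false {a} {b} a≰b with a ≤ᵇ b in eq
  ... | false = refl
  ... | true = ⊥-elim (a≰b (≤ᵇ-true⇒≤ eq))

  hits : ℕ → List ℕ → Bool
  hits p = any (λ a → a ≡ᵇ p)

  ∈⇒hits : ∀ {p as} → p ∈ as → hits p as ≡ true
  ∈⇒hits {p} (here refl) rewrite ≡ᵇ-refl p = refl
  ∈⇒hits {p} {a ∷ _} (there p∈as) rewrite ∈⇒hits p∈as = BP.∨-zeroʳ (a ≡ᵇ p)

  hits⇒∈ : ∀ {p} as → hits p as ≡ true → p ∈ as
  hits⇒∈ {p} (a ∷ as) h with a ≡ᵇ p in eq
  ... | true = here (sym (≡ᵇ-true⇒≡ eq))
  ... | false = there (hits⇒∈ as h)

  applyFamily-≡ : ∀ fs c {p g} → g ∈ fs → p ∈ Op.args g →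
    (∀ {g'} → g' ∈ fs → p ∈ Op.args g' → g' ≡ g) →
    applyFamily fs c p ≡ Op.app g c p
  applyFamily-≡ (op as f ∷ fs) c {p} g∈ p∈g unique with hits p as in eq
  ... | true = cong (λ o → Op.app o c p) (unique (here refl) (hits⇒∈ as eq))
  applyFamily-≡ (op as f ∷ fs) c (here refl) p∈g unique | false with () ← trans (sym eq) (∈⇒hits p∈g)
  applyFamily-≡ (op as f ∷ fs) c (there g∈) p∈g unique | false = applyFamily-≡ fs c g∈ p∈g (unique ∘′ there)

module Envelopes where

  open import Data.Nat as ℕ using (ℕ; suc; _^_; _≤ᵇ_)
  import Data.Nat.Properties as NP
  open import Data.Integer using (ℤ; +_; -[1+_]; _+_; _-_; -_; _⊓_; _⊔_; _≤_; +≤+; -≤+)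
  import Data.Integer.Properties as ZP
  open import Data.Integer.Tactic.RingSolver using (solve-∀)
  open import Data.Bool using (Bool; true; false; if_then_else_; _∨_; _∧_)
  open import Data.Product using (_×_; _,_; proj₁; proj₂)
  open import Data.Sum using (inj₁; inj₂)
  open import Relation.Binary.PropositionalEquality
  open import Function using (_∘_)
  open Families using (≤ᵇ-true⇒≤)

  mersenne : ℕ → ℤ
  mersenne e = + (2 ^ e) - + 1

  mersenne-mono : ∀ {e f} → e ℕ.≤ f → mersenne e ≤ mersenne f
  mersenne-mono e≤f = ZP.+-monoˡ-≤ (- + 1) (+≤+ (NP.^-monoʳ-≤ 2 e≤f))

  mersenne-suc : ∀ e → mersenne (suc e) ≡ mersenne e + mersenne e + + 1
  mersenne-suc e = begin
    + (2 ^ e ℕ.+ (2 ^ e ℕ.+ 0)) - + 1   ≡⟨ cong (λ n → + (2 ^ e ℕ.+ n) - + 1) (NP.+-identityʳ (2 ^ e)) ⟩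
    + (2 ^ e ℕ.+ 2 ^ e) - + 1           ≡⟨ cong (_- + 1) (ZP.pos-+ (2 ^ e) (2 ^ e)) ⟩
    + (2 ^ e) + + (2 ^ e) - + 1         ≡⟨ regroup (+ (2 ^ e)) ⟩
    mersenne e + mersenne e + + 1       ∎
    where
    open ≡-Reasoning
    regroup : ∀ x → x + x - + 1 ≡ (x - + 1) + (x - + 1) + + 1
    regroup = solve-∀

  0≤mersenne : ∀ e → + 0 ≤ mersenne e
  0≤mersenne e = ZP.+-monoˡ-≤ (- + 1) (+≤+ (NP.m^n>0 2 e))

  ≤mersenne-⊓ : ∀ {d} e f → d ≤ mersenne e → d ≤ mersenne f → d ≤ mersenne (e ℕ.⊓ f)
  ≤mersenne-⊓ e f d≤e d≤f with NP.≤-total e f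
  ... | inj₁ e≤f rewrite NP.m≤n⇒m⊓n≡m e≤f = d≤e
  ... | inj₂ f≤e rewrite NP.m≥n⇒m⊓n≡n f≤e = d≤f

  Envelope : Set
  Envelope = Bool × ℕ

  record Within (R : ℤ) (A : Envelope) (d : ℤ) : Set where
    constructor within
    field
      lower-bound : - R ≤ d
      upper-bound : d ≤ R
      exponent-bound : d ≤ mersenne (proj₂ A)
      flag-bound : proj₁ A ≡ true → -[1+ 0 ] ≤ d
  open Within public

  infix 4 _⊑_

  _⊑_ : Envelope → Envelope → Set
  A ⊑ B = (proj₁ B ≡ true → proj₁ A ≡ true) × proj₂ A ℕ.≤ proj₂ B

  within-⊑ : ∀ {R A B d} → A ⊑ B → Within R A d → Within R B d
  within-⊑ (flag⇐ , e≤) (within lo hi ex fl) = within lo hi (ZP.≤-trans ex (mersenne-mono e≤)) (fl ∘ flag⇐)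

  decᴱ : ℕ → Envelope → Envelope
  decᴱ h A = proj₁ A ∧ (proj₂ A ≤ᵇ suc h) , proj₂ A ℕ.⊓ h

  cycᴱ : ℕ → Envelope → Envelope
  cycᴱ M A = true , (if proj₁ A then proj₂ A else M)

  sortᴱ : Envelope → Envelope
  sortᴱ A = proj₁ A ∧ (proj₂ A ≤ᵇ 1) , 0

  infixl 7 _⊓ᴱ_
  infixl 6 _⊔ᴱ_

  _⊓ᴱ_ : Envelope → Envelope → Envelope
  A ⊓ᴱ B = proj₁ A ∧ proj₁ B , proj₂ A ℕ.⊓ proj₂ B

  _⊔ᴱ_ : Envelope → Envelope → Envelope
  A ⊔ᴱ B = proj₁ A ∨ proj₁ B , proj₂ A ℕ.⊔ proj₂ B

  ⊑-refl : ∀ {A} → A ⊑ A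
  ⊑-refl = (λ flagged → flagged) , NP.≤-refl

  private
    ∧-true-l : ∀ {a b} → a ∧ b ≡ true → a ≡ true
    ∧-true-l {true} _ = refl

    ∧-true-r : ∀ {a b} → a ∧ b ≡ true → b ≡ true
    ∧-true-r {true} b≡true = b≡true

  within-⊓ᴱˡ : ∀ {R A B x y} → Within R A x → Within R B y → x ≤ y → Within R (A ⊓ᴱ B) x
  within-⊓ᴱˡ {A = _ , e₁} {_ , e₂} (within lo hi ex fl) wy x≤y =
    within lo hi (≤mersenne-⊓ e₁ e₂ ex (ZP.≤-trans x≤y (exponent-bound wy))) (fl ∘ ∧-true-l)

  within-⊓ᴱʳ : ∀ {R A B x y} → Within R A x → Within R B y → y ≤ x → Within R (A ⊓ᴱ B) y
  within-⊓ᴱʳ {A = l₁ , e₁} {_ , e₂} wx (within lo hi ex fl) y≤x =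
    within lo hi (≤mersenne-⊓ e₁ e₂ (ZP.≤-trans y≤x (exponent-bound wx)) ex) (fl ∘ ∧-true-r {l₁})

  within-⊔ᴱʳ : ∀ {R A B x y} → Within R A x → Within R B y → x ≤ y → Within R (A ⊔ᴱ B) y
  within-⊔ᴱʳ {A = l₁ , e₁} {l₂ , e₂} wx (within lo hi ex fl) x≤y =
    within lo hi (ZP.≤-trans ex (mersenne-mono (NP.m≤n⊔m e₁ e₂))) (flag l₁ l₂ refl refl)
    where
    flag : ∀ u v → l₁ ≡ u → l₂ ≡ v → u ∨ v ≡ true → -[1+ 0 ] ≤ _
    flag true _ l₁≡true _ _ = ZP.≤-trans (flag-bound wx l₁≡true) x≤y
    flag false true _ l₂≡true _ = fl l₂≡true

  within-⊔ᴱˡ : ∀ {R A B x y} → Within R A x → Within R B y → y ≤ x → Within R (A ⊔ᴱ B) x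
  within-⊔ᴱˡ {A = l₁ , e₁} {l₂ , e₂} (within lo hi ex fl) wy y≤x =
    within lo hi (ZP.≤-trans ex (mersenne-mono (NP.m≤m⊔n e₁ e₂))) (flag l₁ l₂ refl refl)
    where
    flag : ∀ u v → l₁ ≡ u → l₂ ≡ v → u ∨ v ≡ true → -[1+ 0 ] ≤ _
    flag true _ l₁≡true _ _ = fl l₁≡true
    flag false true _ l₂≡true _ = ZP.≤-trans (flag-bound wy l₂≡true) y≤x

  private
    open ZP.≤-Reasoning

    x+x-x≡x : ∀ x → x + x - x ≡ x
    x+x-x≡x = solve-∀

    x+x-[x+x+1]≡-1 : ∀ x → x + x - (x + x + + 1) ≡ -[1+ 0 ]
    x+x-[x+x+1]≡-1 = solve-∀

    -2-x≤x : ∀ {x} → -[1+ 0 ] ≤ x → -[1+ 1 ] - x ≤ x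
    -2-x≤x {x} -1≤x = begin
      -[1+ 1 ] - x               ≡⟨ regroup x ⟩
      -[1+ 0 ] + -[1+ 0 ] - x    ≤⟨ ZP.+-monoˡ-≤ (- x) (ZP.+-mono-≤ -1≤x -1≤x) ⟩
      x + x - x                  ≡⟨ x+x-x≡x x ⟩
      x                          ∎
      where
      regroup : ∀ x → -[1+ 1 ] - x ≡ -[1+ 0 ] + -[1+ 0 ] - x
      regroup = solve-∀

    i≤j+k⇒i-j≤k : ∀ {i j k} → i ≤ j + k → i - j ≤ k
    i≤j+k⇒i-j≤k {i} {j} {k} le = subst (i - j ≤_) (cancel j k) (ZP.+-monoˡ-≤ (- j) le)
      where cancel : ∀ j k → j + k - j ≡ k
            cancel = solve-∀

    i≤j+k⇒i-k≤j : ∀ {i j k} → i ≤ j + k → i - k ≤ j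
    i≤j+k⇒i-k≤j {i} {j} {k} le = subst (i - k ≤_) (cancel j k) (ZP.+-monoˡ-≤ (- k) le)
      where cancel : ∀ j k → j + k - k ≡ j
            cancel = solve-∀

    j+k≤i⇒k≤i-j : ∀ {i j k} → j + k ≤ i → k ≤ i - j
    j+k≤i⇒k≤i-j {i} {j} {k} le = subst (_≤ i - j) (cancel j k) (ZP.+-monoˡ-≤ (- j) le)
      where cancel : ∀ j k → j + k - j ≡ k
            cancel = solve-∀

    j+k≤i⇒j≤i-k : ∀ {i j k} → j + k ≤ i → j ≤ i - k
    j+k≤i⇒j≤i-k {i} {j} {k} le = subst (_≤ i - k) (cancel j k) (ZP.+-monoˡ-≤ (- k) le)
      where cancel : ∀ j k → j + k - k ≡ j
            cancel = solve-∀

    sub-anti : ∀ {x y} c → x ≤ y → c - y ≤ c - x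
    sub-anti c x≤y = ZP.+-monoʳ-≤ c (ZP.neg-mono-≤ x≤y)

    -R≤-d : ∀ {R d} → d ≤ R → - R ≤ - d
    -R≤-d = ZP.neg-mono-≤

    -d≤R : ∀ {R d} → - R ≤ d → - d ≤ R
    -d≤R {R} {d} -R≤d = begin
      - d     ≤⟨ ZP.neg-mono-≤ -R≤d ⟩
      - - R   ≡⟨ ZP.neg-involutive R ⟩
      R       ∎

  within-decᴱ-≤ : ∀ {R h A d} → Within R A d → d ≤ mersenne h → Within R (decᴱ h A) d
  within-decᴱ-≤ {h = h} {A = _ , e} (within lo hi ex fl) d≤H = within lo hi (≤mersenne-⊓ e h ex d≤H) (fl ∘ ∧-true-l)

  within-decᴱ-reflect : ∀ {R h A d} → Within R A d → mersenne h ≤ d →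
    Within R (decᴱ h A) (mersenne h + mersenne h - d)
  within-decᴱ-reflect {R} {h} {l , e} {d} (within lo hi ex fl) H≤d =
    within lower (ZP.≤-trans d'≤d hi) (≤mersenne-⊓ e h (ZP.≤-trans d'≤d ex) d'≤H) flag
    where
    H = mersenne h
    d'≤d : H + H - d ≤ d
    d'≤d = begin
      H + H - d   ≤⟨ ZP.+-monoˡ-≤ (- d) (ZP.+-mono-≤ H≤d H≤d) ⟩
      d + d - d   ≡⟨ x+x-x≡x d ⟩
      d           ∎
    d'≤H : H + H - d ≤ H
    d'≤H = begin
      H + H - d   ≤⟨ sub-anti (H + H) H≤d ⟩
      H + H - H   ≡⟨ x+x-x≡x H ⟩
      H           ∎
    lower : - R ≤ H + H - d
    lower = begin
      - R         ≤⟨ -R≤-d hi ⟩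
      - d         ≡⟨ sym (ZP.+-identityˡ (- d)) ⟩
      + 0 - d     ≤⟨ ZP.+-monoˡ-≤ (- d) (ZP.+-mono-≤ (0≤mersenne h) (0≤mersenne h)) ⟩
      H + H - d   ∎
    flag : l ∧ (e ≤ᵇ suc h) ≡ true → -[1+ 0 ] ≤ H + H - d
    flag flagged = begin
      -[1+ 0 ]              ≡⟨ sym (x+x-[x+x+1]≡-1 H) ⟩
      H + H - (H + H + + 1) ≤⟨ sub-anti (H + H) d≤2H+1 ⟩
      H + H - d             ∎
      where
      d≤2H+1 : d ≤ H + H + + 1
      d≤2H+1 = begin
        d                 ≤⟨ ex ⟩
        mersenne e        ≤⟨ mersenne-mono {e} {suc h} (≤ᵇ-true⇒≤ (∧-true-r {l} flagged)) ⟩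
        mersenne (suc h)  ≡⟨ mersenne-suc h ⟩
        H + H + + 1       ∎

  within-cycᴱ-≥ : ∀ {R M A d} → R ≡ mersenne M → Within R A d → -[1+ 0 ] ≤ d → Within R (cycᴱ M A) d
  within-cycᴱ-≥ {A = true , e} _ (within lo hi ex _) -1≤d = within lo hi ex (λ _ → -1≤d)
  within-cycᴱ-≥ {A = false , e} refl (within lo hi _ _) -1≤d = within lo hi hi (λ _ → -1≤d)

  within-cycᴱ-reflect : ∀ {R M A d} → R ≡ mersenne M → Within R A d → d ≤ -[1+ 0 ] →
    Within R (cycᴱ M A) (-[1+ 1 ] - d)
  within-cycᴱ-reflect {R} {M} {l , e} {d} R≡ (within lo hi ex fl) d≤-1 =
    within (ZP.≤-trans (ZP.≤-trans lo d≤-1) -1≤d') upper (exponent l refl) (λ _ → -1≤d')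
    where
    -1≤d' : -[1+ 0 ] ≤ -[1+ 1 ] - d
    -1≤d' = sub-anti -[1+ 1 ] d≤-1
    upper : -[1+ 1 ] - d ≤ R
    upper = begin
      -[1+ 1 ] - d   ≤⟨ ZP.+-monoˡ-≤ (- d) (-≤+ {1} {0}) ⟩
      + 0 - d        ≡⟨ ZP.+-identityˡ (- d) ⟩
      - d            ≤⟨ -d≤R lo ⟩
      R              ∎
    exponent : ∀ l' → l ≡ l' → -[1+ 1 ] - d ≤ mersenne (if l' then e else M)
    exponent true l≡true = ZP.≤-trans (-2-x≤x (fl l≡true)) ex
    exponent false _ = subst (-[1+ 1 ] - d ≤_) R≡ upper

  within-sortᴱ-≤ : ∀ {R A d} → Within R A d → d ≤ + 0 → Within R (sortᴱ A) d
  within-sortᴱ-≤ {A = _ , _} (within lo hi _ fl) d≤0 = within lo hi d≤0 (fl ∘ ∧-true-l)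

  within-sortᴱ-neg : ∀ {R A d} → Within R A d → + 0 ≤ d → Within R (sortᴱ A) (- d)
  within-sortᴱ-neg {A = l , e} (within lo hi ex _) 0≤d = within (-R≤-d hi) (-d≤R lo) (ZP.neg-mono-≤ 0≤d) flag
    where
    flag : l ∧ (e ≤ᵇ 1) ≡ true → -[1+ 0 ] ≤ - _
    flag flagged = ZP.neg-mono-≤ (ZP.≤-trans ex (mersenne-mono {e} {1} (≤ᵇ-true⇒≤ (∧-true-r {l} flagged))))

  record Pair (R s : ℤ) (A : Envelope) (a b : ℤ) : Set where
    constructor pair
    field
      sum≡ : a + b ≡ s
      within-diff : Within R A (a - b)

  private
    Pair-resp : ∀ {R s A a b a' b'} → a' ≡ a → b' ≡ b → Pair R s A a b → Pair R s A a' b'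
    Pair-resp refl refl p = p

  dec-pair : ∀ {R s A a b} h → Pair R s A a b →
    Pair R s (decᴱ h A) (a ⊓ (b + mersenne h)) ((a - mersenne h) ⊔ b)
  dec-pair {R} {s} {A} {a} {b} h (pair sum w) with ZP.≤-total a (b + mersenne h)
  ... | inj₁ a≤b+H =
    Pair-resp (ZP.i≤j⇒i⊓j≡i a≤b+H) (ZP.i≤j⇒i⊔j≡j (i≤j+k⇒i-k≤j a≤b+H))
      (pair sum (within-decᴱ-≤ w (i≤j+k⇒i-j≤k a≤b+H)))
  ... | inj₂ b+H≤a =
    Pair-resp (ZP.i≥j⇒i⊓j≡j b+H≤a) (ZP.i≥j⇒i⊔j≡i (j+k≤i⇒j≤i-k b+H≤a))
      (pair (trans (swap a b (mersenne h)) sum)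
            (subst (Within R (decᴱ h A)) (reflect a b (mersenne h)) (within-decᴱ-reflect w (j+k≤i⇒k≤i-j b+H≤a))))
    where
    swap : ∀ a b H → (b + H) + (a - H) ≡ a + b
    swap = solve-∀
    reflect : ∀ a b H → H + H - (a - b) ≡ (b + H) - (a - H)
    reflect = solve-∀

  cyc-pair : ∀ {R s A a b} M → R ≡ mersenne M → Pair R s A a b →
    Pair R s (cycᴱ M A) (a ⊔ (b - + 1)) ((a + + 1) ⊓ b)
  cyc-pair {R} {s} {A} {a} {b} M R≡ (pair sum w) with ZP.≤-total (b - + 1) a
  ... | inj₁ b-1≤a =
    Pair-resp (ZP.i≥j⇒i⊔j≡i b-1≤a) (ZP.i≥j⇒i⊓j≡j (j+k≤i⇒j≤i-k b-1≤a))
      (pair sum (within-cycᴱ-≥ R≡ w (j+k≤i⇒k≤i-j b-1≤a)))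
  ... | inj₂ a≤b-1 =
    Pair-resp (ZP.i≤j⇒i⊔j≡j a≤b-1) (ZP.i≤j⇒i⊓j≡i (i≤j+k⇒i-k≤j a≤b-1))
      (pair (trans (swap a b) sum)
            (subst (Within R (cycᴱ M A)) (reflect a b) (within-cycᴱ-reflect R≡ w (i≤j+k⇒i-j≤k a≤b-1))))
    where
    swap : ∀ a b → (b - + 1) + (a + + 1) ≡ a + b
    swap = solve-∀
    reflect : ∀ a b → -[1+ 1 ] - (a - b) ≡ (b - + 1) - (a + + 1)
    reflect = solve-∀

  sort-pair : ∀ {R s A a b} → Pair R s A a b → Pair R s (sortᴱ A) (a ⊓ b) (a ⊔ b)
  sort-pair {R} {s} {A} {a} {b} (pair sum w) with ZP.≤-total a b
  ... | inj₁ a≤b =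
    Pair-resp (ZP.i≤j⇒i⊓j≡i a≤b) (ZP.i≤j⇒i⊔j≡j a≤b) (pair sum (within-sortᴱ-≤ w (ZP.i≤j⇒i-j≤0 a≤b)))
  ... | inj₂ b≤a =
    Pair-resp (ZP.i≥j⇒i⊓j≡j b≤a) (ZP.i≥j⇒i⊔j≡i b≤a)
      (pair (trans (ZP.+-comm b a) sum)
            (subst (Within R (sortᴱ A)) (negate a b) (within-sortᴱ-neg w (ZP.i≤j⇒0≤j-i b≤a))))
    where
    negate : ∀ a b → - (a - b) ≡ b - a
    negate = solve-∀

  private
    same-sum-anti : ∀ {s a₁ b₁ a₂ b₂} → a₁ + b₁ ≡ s → a₂ + b₂ ≡ s → a₁ ≤ a₂ → b₂ ≤ b₁
    same-sum-anti {s} {a₁} {b₁} {a₂} {b₂} refl e₂ a₁≤a₂ = begin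
      b₂              ≡⟨ sym (cancel a₂ b₂) ⟩
      a₂ + b₂ - a₂    ≡⟨ cong (_- a₂) e₂ ⟩
      a₁ + b₁ - a₂    ≤⟨ sub-anti (a₁ + b₁) a₁≤a₂ ⟩
      a₁ + b₁ - a₁    ≡⟨ cancel a₁ b₁ ⟩
      b₁              ∎
      where
      cancel : ∀ a b → a + b - a ≡ b
      cancel = solve-∀

    same-sum-diff-mono : ∀ {s a₁ b₁ a₂ b₂} → a₁ + b₁ ≡ s → a₂ + b₂ ≡ s → a₁ ≤ a₂ → a₁ - b₁ ≤ a₂ - b₂
    same-sum-diff-mono e₁ e₂ a₁≤a₂ = ZP.+-mono-≤ a₁≤a₂ (ZP.neg-mono-≤ (same-sum-anti e₁ e₂ a₁≤a₂))

  min-pairs : ∀ {R s A₁ A₂ a₁ b₁ a₂ b₂} → Pair R s A₁ a₁ b₁ → Pair R s A₂ a₂ b₂ →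
    Pair R s (A₁ ⊓ᴱ A₂) (a₁ ⊓ a₂) (b₂ ⊔ b₁)
  min-pairs {a₁ = a₁} {a₂ = a₂} (pair e₁ w₁) (pair e₂ w₂) with ZP.≤-total a₁ a₂
  ... | inj₁ a₁≤a₂ =
    Pair-resp (ZP.i≤j⇒i⊓j≡i a₁≤a₂) (ZP.i≤j⇒i⊔j≡j (same-sum-anti e₁ e₂ a₁≤a₂))
      (pair e₁ (within-⊓ᴱˡ w₁ w₂ (same-sum-diff-mono e₁ e₂ a₁≤a₂)))
  ... | inj₂ a₂≤a₁ =
    Pair-resp (ZP.i≥j⇒i⊓j≡j a₂≤a₁) (ZP.i≥j⇒i⊔j≡i (same-sum-anti e₂ e₁ a₂≤a₁))
      (pair e₂ (within-⊓ᴱʳ w₁ w₂ (same-sum-diff-mono e₂ e₁ a₂≤a₁)))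

  max-pairs : ∀ {R s A₁ A₂ a₁ b₁ a₂ b₂} → Pair R s A₁ a₁ b₁ → Pair R s A₂ a₂ b₂ →
    Pair R s (A₁ ⊔ᴱ A₂) (a₁ ⊔ a₂) (b₂ ⊓ b₁)
  max-pairs {a₁ = a₁} {a₂ = a₂} (pair e₁ w₁) (pair e₂ w₂) with ZP.≤-total a₁ a₂
  ... | inj₁ a₁≤a₂ =
    Pair-resp (ZP.i≤j⇒i⊔j≡j a₁≤a₂) (ZP.i≤j⇒i⊓j≡i (same-sum-anti e₁ e₂ a₁≤a₂))
      (pair e₂ (within-⊔ᴱʳ w₁ w₂ (same-sum-diff-mono e₁ e₂ a₁≤a₂)))
  ... | inj₂ a₂≤a₁ =
    Pair-resp (ZP.i≥j⇒i⊔j≡i a₂≤a₁) (ZP.i≥j⇒i⊓j≡j (same-sum-anti e₂ e₁ a₂≤a₁))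
      (pair e₁ (within-⊔ᴱˡ w₁ w₂ (same-sum-diff-mono e₂ e₁ a₂≤a₁)))

module Halves where

  open import Data.Nat using (zero; suc)
  import Data.Nat.Properties as NP
  open import Data.Integer using (+_; -[1+_]; _+_; _-_; _*_; _≤_; +≤+; -≤-)
  import Data.Integer.Properties as ZP
  open import Data.Integer.Tactic.RingSolver using (solve-∀)
  open import Data.Product using (_×_; _,_)
  open import Data.Sum using (_⊎_; inj₁; inj₂)
  open import Data.Empty using (⊥-elim)
  open import Relation.Binary.PropositionalEquality

  private
    2*≢1 : ∀ z → + 2 * z ≢ + 1
    2*≢1 (+ zero) ()
    2*≢1 (+ suc n) e = NP.m+1+n≢0 n (NP.suc-injective (ZP.+-injective e))
    2*≢1 -[1+ n ] ()

    even≢odd : ∀ x y → + 2 * x ≢ + 2 * y + + 1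
    even≢odd x y e = 2*≢1 (x - y) (begin
      + 2 * (x - y)                   ≡⟨ distrib x y ⟩
      + 2 * x - + 2 * y               ≡⟨ cong (_- + 2 * y) e ⟩
      (+ 2 * y + + 1) - + 2 * y       ≡⟨ cancel y ⟩
      + 1                             ∎)
      where
      open ≡-Reasoning
      distrib : ∀ x y → + 2 * (x - y) ≡ + 2 * x - + 2 * y
      distrib = solve-∀
      cancel : ∀ y → (+ 2 * y + + 1) - + 2 * y ≡ + 1
      cancel = solve-∀

    half : ∀ x y → + 2 * x ≡ + 2 * y → x ≡ y
    half x y = ZP.*-cancelˡ-≡ (+ 2) x y

    +1-injective : ∀ x y → x + + 1 ≡ y + + 1 → x ≡ y
    +1-injective x y e = trans (sym (undo x)) (trans (cong (_- + 1) e) (undo y))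
      where
      undo : ∀ x → x + + 1 - + 1 ≡ x
      undo = solve-∀

    ≥-1∧≤0⇒0⊎-1 : ∀ {d} → -[1+ 0 ] ≤ d → d ≤ + 0 → d ≡ + 0 ⊎ d ≡ -[1+ 0 ]
    ≥-1∧≤0⇒0⊎-1 {+ zero} _ _ = inj₁ refl
    ≥-1∧≤0⇒0⊎-1 {+ suc n} _ (+≤+ ())
    ≥-1∧≤0⇒0⊎-1 { -[1+ zero ]} _ _ = inj₂ refl
    ≥-1∧≤0⇒0⊎-1 { -[1+ suc n ]} (-≤- ()) _

  pair-from-sum : ∀ a b s → a + b ≡ s → -[1+ 0 ] ≤ a - b → a - b ≤ + 0 →
    (∀ q → s ≡ + 2 * q → a ≡ q × b ≡ q) ×
    (∀ q → s ≡ + 2 * q + + 1 → a ≡ q × b ≡ q + + 1)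
  pair-from-sum a b s refl -1≤d d≤0 with ≥-1∧≤0⇒0⊎-1 -1≤d d≤0
  ... | inj₁ d≡0 = even , odd
    where
    b≡a : b ≡ a
    b≡a = sym (ZP.i-j≡0⇒i≡j a b d≡0)
    s≡2a : a + b ≡ + 2 * a
    s≡2a = trans (cong (λ x → a + x) b≡a) (double a)
      where double : ∀ a → a + a ≡ + 2 * a
            double = solve-∀
    even : ∀ q → a + b ≡ + 2 * q → a ≡ q × b ≡ q
    even q e = let a≡q = half a q (trans (sym s≡2a) e) in a≡q , trans b≡a a≡q
    odd : ∀ q → a + b ≡ + 2 * q + + 1 → a ≡ q × b ≡ q + + 1
    odd q e = ⊥-elim (even≢odd a q (trans (sym s≡2a) e))
  ... | inj₂ d≡-1 = even , odd
    where
    b≡a+1 : b ≡ a + + 1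
    b≡a+1 = trans (regroup a b) (cong (a -_) d≡-1)
      where regroup : ∀ a b → b ≡ a - (a - b)
            regroup = solve-∀
    s≡2a+1 : a + b ≡ + 2 * a + + 1
    s≡2a+1 = trans (cong (λ x → a + x) b≡a+1) (double a)
      where double : ∀ a → a + (a + + 1) ≡ + 2 * a + + 1
            double = solve-∀
    even : ∀ q → a + b ≡ + 2 * q → a ≡ q × b ≡ q
    even q e = ⊥-elim (even≢odd q a (trans (sym e) s≡2a+1))
    odd : ∀ q → a + b ≡ + 2 * q + + 1 → a ≡ q × b ≡ q + + 1
    odd q e = let a≡q = half a q (+1-injective _ _ (trans (sym s≡2a+1) e)) in
              a≡q , trans b≡a+1 (cong (_+ + 1) a≡q)

module Positions (m' : ℕ) where

  open import Defs
  open Residues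
  open Families
  open import Data.Nat using (ℕ; zero; suc; _+_; _∸_; _%_; _≡ᵇ_; _≤ᵇ_; z≤n; s≤s; _≤_; _<_; _≤?_)
  import Data.Nat.Properties as NP
  open import Data.Bool using (if_then_else_)
  open import Data.List using (List; _∷_; []; _++_; map; upTo)
  open import Data.List.Membership.Propositional using (_∈_)
  open import Data.List.Membership.Propositional.Properties
  open import Data.List.Relation.Unary.Any using (here; there)
  open import Data.Product using (_×_; _,_)
  open import Data.Sum using (_⊎_; inj₁; inj₂)
  open import Relation.Nullary using (yes; no)
  open import Relation.Nullary.Decidable.Core using (T?)
  open import Relation.Binary.PropositionalEquality
  open import Function using (_∘_)

  m : ℕ
  m = suc m'

  k : ℕ
  k = suc (suc m)

  B : ℕ
  B = b k

  B≡m+m : B ≡ m + m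
  B≡m+m = cong (m +_) (NP.+-identityʳ m)

  B∸m≡m : B ∸ m ≡ m
  B∸m≡m = trans (cong (_∸ m) B≡m+m) (NP.m+n∸m≡n m m)

  m≤B : m ≤ B
  m≤B = subst (m ≤_) (sym B≡m+m) (NP.m≤m+n m m)

  m<B : m < B
  m<B = subst (m <_) (sym B≡m+m) (NP.m<m+n m (s≤s z≤n))

  mirror : ℕ → ℕ
  mirror i = suc (B ∸ i)

  B∸+1≡mirror : ∀ i → B ∸ i + 1 ≡ mirror i
  B∸+1≡mirror i = NP.+-comm (B ∸ i) 1

  m<mirror : ∀ {i} → i ≤ m → m < mirror i
  m<mirror {i} i≤m = s≤s (subst (_≤ B ∸ i) B∸m≡m (NP.∸-monoʳ-≤ B i≤m))

  mirror≢ : ∀ {i p} → i ≤ m → p ≤ m → mirror i ≢ p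
  mirror≢ i≤m p≤m refl = NP.<⇒≱ (m<mirror i≤m) p≤m

  mirror-≤B : ∀ {i} → 1 ≤ i → mirror i ≤ B
  mirror-≤B {suc i} _ = s≤s (NP.m∸n≤m _ i)

  mirror-mirror : ∀ {i} → 1 ≤ i → i ≤ B → mirror (mirror i) ≡ i
  mirror-mirror {suc i} _ (s≤s i<B) = cong suc (NP.m∸[m∸n]≡n i<B)

  mirror-suc : ∀ {i} → i < B → mirror (suc i) ≡ B ∸ i
  mirror-suc i<B = sym (NP.+-∸-assoc 1 i<B)

  mirror-suc-<m : ∀ {i} → i < m → mirror (suc i) ≡ B ∸ i
  mirror-suc-<m i<m = mirror-suc (NP.<-≤-trans i<m m≤B)

  mirror-m : mirror m ≡ suc m
  mirror-m = cong suc B∸m≡m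

  lower : ℕ → ℕ
  lower p = if p ≤ᵇ m then p else mirror p

  lower-≤ : ∀ {p} → p ≤ m → lower p ≡ p
  lower-≤ p≤m rewrite ≤⇒≤ᵇ-true p≤m = refl

  lower-> : ∀ {p} → m < p → lower p ≡ mirror p
  lower-> m<p rewrite ≰⇒≤ᵇ-false (NP.<⇒≱ m<p) = refl

  lower-mirror : ∀ {i} → 1 ≤ i → i ≤ m → lower (mirror i) ≡ i
  lower-mirror 1≤i i≤m = trans (lower-> (m<mirror i≤m)) (mirror-mirror 1≤i (NP.≤-trans i≤m m≤B))

  mirror≤m : ∀ {p} → m < p → mirror p ≤ m
  mirror≤m m<p = NP.≤-trans (s≤s (NP.∸-monoʳ-≤ B m<p)) (NP.≤-reflexive (trans (mirror-suc m<B) B∸m≡m))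

  lower-range : ∀ {p} → 1 ≤ p → p ≤ B →
    1 ≤ lower p × lower p ≤ m × (p ≡ lower p ⊎ p ≡ mirror (lower p))
  lower-range {p} 1≤p p≤B with p ≤? m
  ... | yes p≤m rewrite lower-≤ p≤m = 1≤p , p≤m , inj₁ refl
  ... | no p≰m rewrite lower-> (NP.≰⇒> p≰m) =
    s≤s z≤n , mirror≤m (NP.≰⇒> p≰m) , inj₂ (sym (mirror-mirror 1≤p p≤B))

  ∈idx⁻ : ∀ {r i} → i ∈ idx k r → 1 ≤ i × i ≤ m × mod3 i ≡ r
  ∈idx⁻ {r} i∈ with i∈' , test ← ∈-filter⁻ (T? ∘ (λ x → x % 3 ≡ᵇ r)) {xs = map suc (upTo m)} i∈
                   with j , j∈ , refl ← ∈-map⁻ suc i∈' =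
    s≤s z≤n , ∈-upTo⁻ j∈ , trans (sym (%3≡mod3 (suc j))) (NP.≡ᵇ⇒≡ _ _ test)

  ∈idx⁺ : ∀ {r i} → 1 ≤ i → i ≤ m → mod3 i ≡ r → i ∈ idx k r
  ∈idx⁺ {r} {suc j} _ i≤m e =
    ∈-filter⁺ (T? ∘ (λ x → x % 3 ≡ᵇ r)) (∈-map⁺ suc (∈-upTo⁺ i≤m))
      (NP.≡⇒≡ᵇ _ _ (trans (%3≡mod3 (suc j)) e))

  -- Acts t g: g belongs to the family applied in round t, that is Q^k_{(t mod 3)+1}.
  data Acts (t : ℕ) : Op → Set where
    cyc-acts : mod3 t ≡ 0 → Acts t (cycOp k)
    dec-acts : ∀ {i} → 1 ≤ i → i ≤ m → mod3 (i + t) ≡ 2 → Acts t (decOp k i)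
    mov-acts : ∀ {i} → 1 ≤ i → i ≤ m → mod3 (i + t) ≡ 0 → Acts t (movOp k i)

  private
    DecMov : ℕ → ℕ → List Op
    DecMov r₁ r₂ = map (decOp k) (idx k r₁) ++ map (movOp k) (idx k r₂)

    DecMov⇒Acts : ∀ {t g} r₁ r₂ → mod3 (r₁ + t) ≡ 2 → mod3 (r₂ + t) ≡ 0 → g ∈ DecMov r₁ r₂ → Acts t g
    DecMov⇒Acts {t} r₁ r₂ e₁ e₂ g∈ with ∈-++⁻ (map (decOp k) (idx k r₁)) g∈
    ... | inj₁ g∈dec with i , i∈ , refl ← ∈-map⁻ (decOp k) g∈dec
                     with 1≤i , i≤m , ri ← ∈idx⁻ {r₁} i∈ =
      dec-acts 1≤i i≤m (trans (mod3-+ˡ i t) (trans (cong (λ x → mod3 (x + t)) ri) e₁))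
    ... | inj₂ g∈mov with i , i∈ , refl ← ∈-map⁻ (movOp k) g∈mov
                     with 1≤i , i≤m , ri ← ∈idx⁻ {r₂} i∈ =
      mov-acts 1≤i i≤m (trans (mod3-+ˡ i t) (trans (cong (λ x → mod3 (x + t)) ri) e₂))

    dec∈DecMov : ∀ {i r₁} r₂ → 1 ≤ i → i ≤ m → mod3 i ≡ r₁ → decOp k i ∈ DecMov r₁ r₂
    dec∈DecMov r₂ 1≤i i≤m e = ∈-++⁺ˡ (∈-map⁺ (decOp k) (∈idx⁺ 1≤i i≤m e))

    mov∈DecMov : ∀ {i r₂} r₁ → 1 ≤ i → i ≤ m → mod3 i ≡ r₂ → movOp k i ∈ DecMov r₁ r₂
    mov∈DecMov r₁ 1≤i i≤m e = ∈-++⁺ʳ (map (decOp k) (idx k r₁)) (∈-map⁺ (movOp k) (∈idx⁺ 1≤i i≤m e))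

    residue-from-sum : ∀ i t {ρ} r → mod3 t ≡ ρ → mod3 (i + t) ≡ mod3 (r + ρ) → mod3 i ≡ mod3 r
    residue-from-sum i t r et e = mod3-+-cancelʳ i r t (trans e (sym (mod3-+ʳ-≡ r t et)))

  ∈Q⇒Acts : ∀ t {g} → g ∈ Qset k (suc (mod3 t)) → Acts t g
  ∈Q⇒Acts t g∈ with mod3 t in et | residue t | g∈
  ... | .0 | 0₃ | here refl = cyc-acts et
  ... | .0 | 0₃ | there g∈' = DecMov⇒Acts {t} 2 0 (mod3-+ʳ-≡ 2 t et) (mod3-+ʳ-≡ 0 t et) g∈'
  ... | .1 | 1₃ | g∈' = DecMov⇒Acts {t} 1 2 (mod3-+ʳ-≡ 1 t et) (mod3-+ʳ-≡ 2 t et) g∈'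
  ... | .2 | 2₃ | g∈' = DecMov⇒Acts {t} 0 1 (mod3-+ʳ-≡ 0 t et) (mod3-+ʳ-≡ 1 t et) g∈'

  Acts⇒∈Q : ∀ t {g} → Acts t g → g ∈ Qset k (suc (mod3 t))
  Acts⇒∈Q t (cyc-acts e) rewrite e = here refl
  Acts⇒∈Q t (dec-acts {i} 1≤i i≤m e) with mod3 t in et | residue t
  ... | .0 | 0₃ = there (dec∈DecMov 0 1≤i i≤m (residue-from-sum i t 2 et e))
  ... | .1 | 1₃ = dec∈DecMov 2 1≤i i≤m (residue-from-sum i t 1 et e)
  ... | .2 | 2₃ = dec∈DecMov 1 1≤i i≤m (residue-from-sum i t 0 et e)
  Acts⇒∈Q t (mov-acts {i} 1≤i i≤m e) with mod3 t in et | residue t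
  ... | .0 | 0₃ = there (mov∈DecMov 2 1≤i i≤m (residue-from-sum i t 0 et e))
  ... | .1 | 1₃ = mov∈DecMov 1 1≤i i≤m (residue-from-sum i t 2 et e)
  ... | .2 | 2₃ = mov∈DecMov 0 1≤i i≤m (residue-from-sum i t 1 et e)

  -- The operation that acts on pair l in a round t with (l + t) mod 3 = r.
  opFor : ℕ → ℕ → Op
  opFor 0 l = movOp k l
  opFor 1 (suc zero) = cycOp k
  opFor 1 l = movOp k (l ∸ 1)
  opFor _ l = decOp k l

  actingOp : ℕ → ℕ → Op
  actingOp t p = opFor (mod3 (lower p + t)) (lower p)

  actingOp-≡ : ∀ t p {l r} → lower p ≡ l → mod3 (l + t) ≡ r → actingOp t p ≡ opFor r l
  actingOp-≡ t p refl refl = refl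

  opFor-1 : ∀ {i} → 1 ≤ i → opFor 1 (suc i) ≡ movOp k i
  opFor-1 (s≤s z≤n) = refl

  private
    lower-B : lower B ≡ 1
    lower-B = trans (lower-> m<B) (cong suc (NP.n∸n≡0 B))

  Acts-unique : ∀ t {g p} → Acts t g → p ∈ Op.args g → g ≡ actingOp t p
  Acts-unique t (cyc-acts e) (here refl) = sym (actingOp-≡ t 1 (lower-≤ (s≤s z≤n)) (mod3-+ʳ-≡ 1 t e))
  Acts-unique t (cyc-acts e) (there (here refl)) = sym (actingOp-≡ t B lower-B (mod3-+ʳ-≡ 1 t e))
  Acts-unique t (dec-acts {i} 1≤i i≤m e) (here refl) = sym (actingOp-≡ t i (lower-≤ i≤m) e)
  Acts-unique t (dec-acts {i} 1≤i i≤m e) (there (here refl)) =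
    sym (actingOp-≡ t (B ∸ i + 1) (trans (cong lower (B∸+1≡mirror i)) (lower-mirror 1≤i i≤m)) e)
  Acts-unique t (mov-acts {i} 1≤i i≤m e) (here refl) = sym (actingOp-≡ t i (lower-≤ i≤m) e)
  Acts-unique t (mov-acts {i} 1≤i i≤m e) (there (here refl)) with NP.m≤n⇒m<n∨m≡n i≤m
  ... | inj₁ i<m = sym (trans (actingOp-≡ t (suc i) (lower-≤ i<m) (mod3-suc-≡ (i + t) e)) (opFor-1 1≤i))
  ... | inj₂ refl = sym (actingOp-≡ t (suc m) (trans (cong lower (sym mirror-m)) (lower-mirror 1≤i i≤m)) e)
  Acts-unique t (mov-acts {i} 1≤i i≤m e) (there (there (here refl))) with NP.m≤n⇒m<n∨m≡n i≤m
  ... | inj₁ i<m = sym (trans (actingOp-≡ t (B ∸ i) lower-B∸i (mod3-suc-≡ (i + t) e)) (opFor-1 1≤i))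
    where
    lower-B∸i : lower (B ∸ i) ≡ suc i
    lower-B∸i = trans (cong lower (sym (mirror-suc-<m i<m))) (lower-mirror (s≤s z≤n) i<m)
  ... | inj₂ refl = sym (actingOp-≡ t (B ∸ m) (trans (cong lower B∸m≡m) (lower-≤ i≤m)) e)
  Acts-unique t (mov-acts {i} 1≤i i≤m e) (there (there (there (here refl)))) =
    sym (actingOp-≡ t (mirror i) (lower-mirror 1≤i i≤m) e)

  private
    ActsAt : ℕ → ℕ → Op → Set
    ActsAt t p g = Acts t g × p ∈ Op.args g

    opFor-1-acts : ∀ t {l p} → 1 ≤ l → l ≤ m → p ≡ l ⊎ p ≡ mirror l → mod3 (l + t) ≡ 1 → ActsAt t p (opFor 1 l)
    opFor-1-acts t {suc zero} _ _ side e = cyc-acts (mod3-suc≡1 t e) , args side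
      where
      args : ∀ {p} → p ≡ 1 ⊎ p ≡ mirror 1 → p ∈ 1 ∷ B ∷ []
      args (inj₁ refl) = here refl
      args (inj₂ refl) = there (here refl)
    opFor-1-acts t {suc (suc i)} _ l≤m side e =
      mov-acts (s≤s z≤n) (NP.<⇒≤ l≤m) (mod3-suc≡1 (suc i + t) e) , args side
      where
      args : ∀ {p} → p ≡ suc (suc i) ⊎ p ≡ mirror (suc (suc i)) → p ∈ Op.args (movOp k (suc i))
      args (inj₁ refl) = there (here refl)
      args (inj₂ refl) = there (there (here (mirror-suc-<m l≤m)))

    opFor-acts : ∀ t {l p} → 1 ≤ l → l ≤ m → p ≡ l ⊎ p ≡ mirror l → ActsAt t p (opFor (mod3 (l + t)) l)
    opFor-acts t {l} 1≤l l≤m side with mod3 (l + t) in e | residue (l + t)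
    ... | .0 | 0₃ = mov-acts 1≤l l≤m e , args side
      where
      args : ∀ {p} → p ≡ l ⊎ p ≡ mirror l → p ∈ Op.args (movOp k l)
      args (inj₁ refl) = here refl
      args (inj₂ refl) = there (there (there (here refl)))
    ... | .1 | 1₃ = opFor-1-acts t 1≤l l≤m side e
    ... | .2 | 2₃ = dec-acts 1≤l l≤m e , args side
      where
      args : ∀ {p} → p ≡ l ⊎ p ≡ mirror l → p ∈ Op.args (decOp k l)
      args (inj₁ refl) = here refl
      args (inj₂ refl) = there (here (sym (B∸+1≡mirror l)))

  Q-at : ∀ t c {p} → 1 ≤ p → p ≤ B → Q k (suc (mod3 t)) c p ≡ Op.app (actingOp t p) c p
  Q-at t c 1≤p p≤B with 1≤l , l≤m , side ← lower-range 1≤p p≤B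
                   with acts , p∈ ← opFor-acts t 1≤l l≤m side =
    applyFamily-≡ (Qset k (suc (mod3 t))) c (Acts⇒∈Q t acts) p∈ (λ g∈ p∈g → Acts-unique t (∈Q⇒Acts t g∈) p∈g)

  Q-at-lower : ∀ t x {i r} → 1 ≤ i → i ≤ m → mod3 (i + t) ≡ r → Q k (suc (mod3 t)) x i ≡ Op.app (opFor r i) x i
  Q-at-lower t x {i} 1≤i i≤m e =
    trans (Q-at t x 1≤i (NP.≤-trans i≤m m≤B)) (cong (λ o → Op.app o x i) (actingOp-≡ t i (lower-≤ i≤m) e))

  Q-at-mirror : ∀ t x {i r} → 1 ≤ i → i ≤ m → mod3 (i + t) ≡ r →
    Q k (suc (mod3 t)) x (mirror i) ≡ Op.app (opFor r i) x (mirror i)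
  Q-at-mirror t x {i} 1≤i i≤m e =
    trans (Q-at t x (s≤s z≤n) (mirror-≤B 1≤i))
          (cong (λ o → Op.app o x (mirror i)) (actingOp-≡ t (mirror i) (lower-mirror 1≤i i≤m) e))

module Schedule (m' : ℕ) where

  open Residues
  open Families
  open Envelopes
  open import Data.Nat using (zero; suc; _+_; _*_; _∸_; _≤ᵇ_; z≤n; s≤s; _≤_; _<_; _≤?_)
  import Data.Nat.Properties as NP
  open import Data.Nat.Tactic.RingSolver using (solve-∀)
  open import Data.Bool using (true; false; if_then_else_; _∧_; _∨_; not)
  open import Data.Product using (_,_; proj₁; proj₂)
  open import Data.Empty using (⊥-elim)
  open import Relation.Nullary using (¬_; Dec; yes; no)
  open import Relation.Binary.PropositionalEquality

  m : ℕ
  m = suc m'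

  -- h_i = 2^(hexp i) - 1
  hexp : ℕ → ℕ
  hexp i = suc m ∸ i

  Settled : ℕ → ℕ → Set
  Settled T i = 2 * i + 3 * m ≤ T + 2

  Settled? : ∀ T i → Dec (Settled T i)
  Settled? T i = 2 * i + 3 * m ≤? T + 2

  Flagged : ℕ → ℕ → Set
  Flagged T i = 2 * i ≤ T + 1

  private
    cancel-≤ : ∀ {P Q L R'} K → L ≡ K + P → R' ≡ K + Q → L ≤ R' → P ≤ Q
    cancel-≤ K eL eR h = NP.+-cancelˡ-≤ K _ _ (subst₂ _≤_ eL eR h)

    ≤∧≰⇒≡ : ∀ {a b} → a ≤ suc b → ¬ a ≤ b → a ≡ suc b
    ≤∧≰⇒≡ le nle = NP.≤-antisym le (NP.≰⇒> nle)

  ¬Settled-early : ∀ {T i} → 1 ≤ i → T ≤ 2 → ¬ Settled T i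
  ¬Settled-early {T} {suc i} _ T≤2 settled =
    NP.<⇒≱ (s≤s (NP.+-monoˡ-≤ 2 T≤2)) (NP.≤-trans (subst (5 ≤_) (sym (expand i m')) (NP.m≤m+n 5 _)) settled)
    where
    expand : ∀ i m' → 2 * suc i + 3 * suc m' ≡ 5 + (2 * i + 3 * m')
    expand = solve-∀

  Settled-pred : ∀ {T i} → Settled (suc T) (suc i) → Settled T i
  Settled-pred {T} {i} settled = NP.≤-trans (cancel-≤ 2 (expand i m) (regroup T) settled) (NP.+-monoʳ-≤ T (NP.n≤1+n 1))
    where
    expand : ∀ i m → 2 * suc i + 3 * m ≡ 2 + (2 * i + 3 * m)
    expand = solve-∀
    regroup : ∀ T → suc T + 2 ≡ 2 + (T + 1)
    regroup = solve-∀

  Settled⇒Flagged : ∀ {T i} → Settled (suc T) i → Flagged T i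
  Settled⇒Flagged {T} {i} settled =
    NP.≤-trans (NP.≤-trans (NP.m≤m+n (2 * i) (3 * m')) (cancel-≤ 3 (expand i m') (regroup T) settled)) (NP.m≤m+n T 1)
    where
    expand : ∀ i m' → 2 * i + 3 * suc m' ≡ 3 + (2 * i + 3 * m')
    expand = solve-∀
    regroup : ∀ T → suc T + 2 ≡ 3 + T
    regroup = solve-∀

  settling-residue : ∀ {T i} → Settled (suc T) i → ¬ Settled T i → mod3 (i + T) ≡ 0
  settling-residue {T} {i} settled unsettled = begin
    mod3 (i + T)                ≡⟨ sym (mod3-+3* (i + T) 1) ⟩
    mod3 (i + T + 3 * 1)        ≡⟨ cong mod3 multiple ⟩
    mod3 (0 + 3 * (i + m))      ≡⟨ mod3-+3* 0 (i + m) ⟩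
    0                           ∎
    where
    open ≡-Reasoning
    step : 2 * i + 3 * m ≡ suc (T + 2)
    step = ≤∧≰⇒≡ settled unsettled
    regroup : ∀ i T → (i + T) + 3 * 1 ≡ i + suc (T + 2)
    regroup = solve-∀
    expand : ∀ i m → i + (2 * i + 3 * m) ≡ 0 + 3 * (i + m)
    expand = solve-∀
    multiple : (i + T) + 3 * 1 ≡ 0 + 3 * (i + m)
    multiple = trans (regroup i T) (trans (cong (i +_) (sym step)) (expand i m))

  Flagged-pred : ∀ {T i} → Flagged (suc T) (suc i) → Flagged T i
  Flagged-pred {T} {i} flagged = NP.≤-trans (cancel-≤ 2 (expand i) (regroup T) flagged) (NP.m≤m+n T 1)
    where
    expand : ∀ i → 2 * suc i ≡ 2 + 2 * i
    expand = solve-∀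
    regroup : ∀ T → suc T + 1 ≡ 2 + T
    regroup = solve-∀

  ¬Flagged₀ : ∀ {i} → 1 ≤ i → ¬ Flagged 0 i
  ¬Flagged₀ {suc i} _ flagged = NP.<⇒≱ (s≤s (s≤s z≤n)) (subst (_≤ 1) (expand i) flagged)
    where
    expand : ∀ i → 2 * suc i ≡ 2 + 2 * i
    expand = solve-∀

  flagging-residue : ∀ {T i} → Flagged (suc T) i → ¬ Flagged T i → mod3 (i + T) ≡ 1
  flagging-residue {T} {i} flagged unflagged = mod3-2+≡0 (i + T) (trans (cong mod3 multiple) (mod3-+3* 0 i))
    where
    step : 2 * i ≡ suc (T + 1)
    step = ≤∧≰⇒≡ flagged unflagged
    regroup : ∀ i T → suc (suc (i + T)) ≡ i + suc (T + 1)
    regroup = solve-∀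
    expand : ∀ i → i + 2 * i ≡ 0 + 3 * i
    expand = solve-∀
    multiple : suc (suc (i + T)) ≡ 0 + 3 * i
    multiple = trans (regroup i T) (trans (cong (i +_) (sym step)) (expand i))

  Flagged⇒late : ∀ {T i} → Flagged (suc T) (suc (suc i)) → ¬ suc T ≤ 2
  Flagged⇒late {T} {i} flagged T<2 =
    NP.<⇒≱ (s≤s (NP.+-monoˡ-≤ 1 T<2)) (NP.≤-trans (subst (4 ≤_) (sym (expand i)) (NP.m≤m+n 4 (2 * i))) flagged)
    where
    expand : ∀ i → 2 * suc (suc i) ≡ 4 + 2 * i
    expand = solve-∀

  3m≤⇒Flagged : ∀ {i t} → i ≤ m → 3 * m ≤ i + suc t → Flagged t i
  3m≤⇒Flagged {i} {t} i≤m 3m≤ = cancel-≤ i (expand i) (regroup i t) (NP.≤-trans (NP.*-monoʳ-≤ 3 i≤m) 3m≤)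
    where
    expand : ∀ i → 3 * i ≡ i + 2 * i
    expand = solve-∀
    regroup : ∀ i t → i + suc t ≡ i + (t + 1)
    regroup = solve-∀

  ¬3m≤i+2 : ∀ {i} → i < m → ¬ 3 * m ≤ i + 2
  ¬3m≤i+2 {i} i<m 3m≤ =
    NP.<-irrefl refl (NP.≤-trans (cancel-≤ 0 (expand i) refl (NP.≤-trans (NP.*-monoʳ-≤ 3 i<m) 3m≤))
                                  (NP.m≤m+n (i + 2) (2 * i)))
    where
    expand : ∀ i → 3 * suc i ≡ 0 + suc (i + 2 + 2 * i)
    expand = solve-∀

  Settled⇒3m≤ : ∀ {i t} → 1 ≤ i → Settled (3 + t) i → 3 * m ≤ suc i + suc (suc t)
  Settled⇒3m≤ {i} {t} 1≤i settled =
    NP.≤-trans (cancel-≤ 2 refl (regroup t) (NP.≤-trans (NP.+-monoˡ-≤ (3 * m) (NP.*-monoʳ-≤ 2 1≤i)) settled))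
               (subst (t + 3 ≤_) (sym (regroup' i t)) (NP.m≤n+m (t + 3) i))
    where
    regroup : ∀ t → 3 + t + 2 ≡ 2 + (t + 3)
    regroup = solve-∀
    regroup' : ∀ i t → suc i + suc (suc t) ≡ i + (t + 3)
    regroup' = solve-∀

  settling-exponent : ∀ {i t} → 1 ≤ i → 2 * i + 3 * m ≡ suc (suc (suc t) + 2) → suc m ≤ suc i + t
  settling-exponent {suc i} {t} _ step =
    s≤s (subst (m ≤_) (sym (cong (suc i +_) t≡)) (subst (m ≤_) (sym (regroup i m')) (NP.m≤n+m m (i + 2 * i + 2 * m'))))
    where
    expand : ∀ i m' → 2 * suc i + 3 * suc m' ≡ 5 + (2 * i + 3 * m')
    expand = solve-∀
    expand' : ∀ t → suc (suc (suc t) + 2) ≡ 5 + t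
    expand' = solve-∀
    t≡ : t ≡ 2 * i + 3 * m'
    t≡ = sym (NP.+-cancelˡ-≡ 5 _ _ (trans (sym (expand i m')) (trans step (expand' t))))
    regroup : ∀ i m' → suc i + (2 * i + 3 * m') ≡ (i + 2 * i + 2 * m') + suc m'
    regroup = solve-∀

  hexp-suc : ∀ {i} → i ≤ m → hexp i ≡ suc (hexp (suc i))
  hexp-suc i≤m = NP.+-∸-assoc 1 i≤m

  hexp≤m : ∀ {i} → 1 ≤ i → hexp i ≤ m
  hexp≤m {suc i} _ = NP.m∸n≤m m i

  hexp-m : hexp m ≡ 1
  hexp-m = NP.m+n∸n≡m 1 m

  ⊤ᴱ : Envelope
  ⊤ᴱ = false , suc m

  -- slot r t i is the envelope of pair i after round suc t when the operation of that round on the pair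
  -- was dec (r = 0), the min or sort half of a mov (r = 1), or cyc or the max half of a mov (r = 2).
  slot : ℕ → ℕ → ℕ → Envelope
  slot 0 t i = (2 * i ≤ᵇ suc t + 1) , hexp i
  slot 1 zero i = ⊤ᴱ
  slot 1 (suc t) i = (3 * m ≤ᵇ i + suc (suc t)) , suc m ∸ (i + t)
  slot 2 t i = if not (2 * i ≤ᵇ suc t + 1) ∧ (suc t ≤ᵇ 2) then ⊤ᴱ else ((2 * i ≤ᵇ suc t + 1) , suc (hexp i))
  slot _ t i = ⊤ᴱ

  -- envelope t i bounds the difference of pair i after t rounds; (true , 0) confines it to {-1, 0}.
  envelope : ℕ → ℕ → Envelope
  envelope zero i = ⊤ᴱ
  envelope (suc t) i = if 2 * i + 3 * m ≤ᵇ suc t + 2 then (true , 0) else slot (mod3 (i + suc t)) t i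

  envelope-settled : ∀ t i → Settled (suc t) i → envelope (suc t) i ≡ (true , 0)
  envelope-settled t i settled rewrite ≤⇒≤ᵇ-true settled = refl

  envelope-unsettled : ∀ t i → ¬ Settled (suc t) i → envelope (suc t) i ≡ slot (mod3 (i + suc t)) t i
  envelope-unsettled t i unsettled rewrite ≰⇒≤ᵇ-false unsettled = refl

  envelope-final : ∀ {i} → i ≤ m → envelope (suc (suc (suc (5 * m')))) i ≡ (true , 0)
  envelope-final {i} i≤m = envelope-settled (suc (suc (5 * m'))) i settled
    where
    total : ∀ m' → 2 * suc m' + 3 * suc m' ≡ suc (suc (suc (5 * m'))) + 2
    total = solve-∀
    settled : Settled (suc (suc (suc (5 * m')))) i
    settled = subst (2 * i + 3 * m ≤_) (total m') (NP.+-monoˡ-≤ (3 * m) (NP.*-monoʳ-≤ 2 i≤m))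

  slot₂-flagged : ∀ t i → Flagged (suc t) i → slot 2 t i ≡ (true , suc (hexp i))
  slot₂-flagged t i flagged rewrite ≤⇒≤ᵇ-true flagged = refl

  slot₂-late : ∀ t i → ¬ suc t ≤ 2 → slot 2 t i ≡ ((2 * i ≤ᵇ suc t + 1) , suc (hexp i))
  slot₂-late t i late rewrite ≰⇒≤ᵇ-false late with 2 * i ≤ᵇ suc t + 1
  ... | true = refl
  ... | false = refl

  slot₂-early : ∀ t i → ¬ Flagged (suc t) i → suc t ≤ 2 → slot 2 t i ≡ ⊤ᴱ
  slot₂-early t i unflagged early rewrite ≰⇒≤ᵇ-false unflagged | ≤⇒≤ᵇ-true early = refl

  slot-exp≤ : ∀ r t {i} → 1 ≤ i → proj₂ (slot r t i) ≤ suc m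
  slot-exp≤ 0 t {i} _ = NP.m∸n≤m (suc m) i
  slot-exp≤ 1 zero _ = NP.≤-refl
  slot-exp≤ 1 (suc t) {i} _ = NP.m∸n≤m (suc m) (i + t)
  slot-exp≤ 2 t {i} 1≤i with not (2 * i ≤ᵇ suc t + 1) ∧ (suc t ≤ᵇ 2)
  ... | true = NP.≤-refl
  ... | false = s≤s (hexp≤m 1≤i)
  slot-exp≤ (suc (suc (suc r))) t _ = NP.≤-refl

  envelope-exp≤ : ∀ t {i} → 1 ≤ i → proj₂ (envelope t i) ≤ suc m
  envelope-exp≤ zero _ = NP.≤-refl
  envelope-exp≤ (suc t) {i} 1≤i with 2 * i + 3 * m ≤ᵇ suc t + 2
  ... | true = z≤n
  ... | false = slot-exp≤ (mod3 (i + suc t)) t 1≤i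

  private
    ¬Settled₁ : ∀ {i} → 1 ≤ i → ¬ Settled 1 i
    ¬Settled₁ 1≤i = ¬Settled-early 1≤i (s≤s z≤n)

    ⊑⊤ᴱ : ∀ {A} → proj₂ A ≤ suc m → A ⊑ ⊤ᴱ
    ⊑⊤ᴱ e≤ = (λ ()) , e≤

    decᴱ-flag : ∀ t {i} → 1 ≤ i → mod3 (i + t) ≡ 2 → Flagged (suc t) i → proj₁ (decᴱ (hexp i) (envelope t i)) ≡ true
    decᴱ-flag zero {i} 1≤i r flagged with () ← trans (sym (flagging-residue {0} {i} flagged (¬Flagged₀ 1≤i))) r
    decᴱ-flag (suc t) {i} 1≤i r flagged with Settled? (suc t) i
    ... | yes settled rewrite envelope-settled t i settled = refl
    ... | no unsettled rewrite envelope-unsettled t i unsettled | r with 2 * i ≤? suc t + 1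
    ...   | yes flagged' rewrite slot₂-flagged t i flagged' | ≤⇒≤ᵇ-true (NP.≤-refl {suc (hexp i)}) = refl
    ...   | no unflagged with () ← trans (sym (flagging-residue {suc t} {i} flagged unflagged)) r

  decᴱ-⊑ : ∀ t {i} → 1 ≤ i → mod3 (i + t) ≡ 2 → decᴱ (hexp i) (envelope t i) ⊑ envelope (suc t) i
  decᴱ-⊑ t {i} 1≤i r with Settled? (suc t) i
  decᴱ-⊑ zero 1≤i r | yes settled = ⊥-elim (¬Settled₁ 1≤i settled)
  decᴱ-⊑ (suc t) {i} 1≤i r | yes settled rewrite envelope-settled (suc t) i settled with Settled? (suc t) i
  ... | yes settled' rewrite envelope-settled t i settled' = ⊑-refl
  ... | no unsettled with () ← trans (sym (settling-residue {suc t} {i} settled unsettled)) r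
  decᴱ-⊑ t {i} 1≤i r | no unsettled rewrite envelope-unsettled t i unsettled | mod3-+suc-≡ i t r =
    (λ flagged → decᴱ-flag t 1≤i r (≤ᵇ-true⇒≤ flagged)) , NP.m⊓n≤n _ (hexp i)

  private
    sortᴱ-flag : ∀ t → mod3 (m + suc t) ≡ 0 → Flagged (suc t) m → proj₁ (sortᴱ (envelope (suc t) m)) ≡ true
    sortᴱ-flag t r flagged with Settled? (suc t) m
    ... | yes settled rewrite envelope-settled t m settled = refl
    ... | no unsettled rewrite envelope-unsettled t m unsettled | r | ≤⇒≤ᵇ-true flagged | hexp-m = refl

  sortᴱ-⊑ : ∀ t → mod3 (m + t) ≡ 0 → sortᴱ (envelope t m) ⊑ envelope (suc t) m
  sortᴱ-⊑ t r with Settled? (suc t) m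
  sortᴱ-⊑ zero r | yes settled = ⊥-elim (¬Settled₁ {m} (s≤s z≤n) settled)
  sortᴱ-⊑ (suc t) r | yes settled rewrite envelope-settled (suc t) m settled =
    (λ _ → sortᴱ-flag t r (Settled⇒Flagged {suc t} {m} settled)) , z≤n
  sortᴱ-⊑ zero r | no unsettled rewrite envelope-unsettled zero m unsettled | mod3-+suc-≡ m zero r = (λ ()) , z≤n
  sortᴱ-⊑ (suc t) r | no unsettled rewrite envelope-unsettled (suc t) m unsettled | mod3-+suc-≡ m (suc t) r =
    (λ flagged → sortᴱ-flag t r (3m≤⇒Flagged {m} {suc t} NP.≤-refl (≤ᵇ-true⇒≤ flagged))) , z≤n

  cycᴱ-⊑ : ∀ t → mod3 (1 + t) ≡ 1 → cycᴱ (suc m) (envelope t 1) ⊑ envelope (suc t) 1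
  cycᴱ-⊑ t r with Settled? (suc t) 1
  cycᴱ-⊑ zero r | yes settled = ⊥-elim (¬Settled₁ {1} (s≤s z≤n) settled)
  cycᴱ-⊑ (suc t) r | yes settled rewrite envelope-settled (suc t) 1 settled with Settled? (suc t) 1
  ... | yes settled' rewrite envelope-settled t 1 settled' = ⊑-refl
  ... | no unsettled with () ← trans (sym (settling-residue {suc t} {1} settled unsettled)) r
  cycᴱ-⊑ t r | no unsettled rewrite envelope-unsettled t 1 unsettled | mod3-+suc-≡ 1 t r
                                    | slot₂-flagged t 1 (s≤s (NP.m≤n+m 1 t)) =
    (λ _ → refl) , cycᴱ-exp (envelope t 1) (envelope-exp≤ t (s≤s z≤n))
    where
    cycᴱ-exp : ∀ A → proj₂ A ≤ suc m → proj₂ (cycᴱ (suc m) A) ≤ suc m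
    cycᴱ-exp (true , _) e≤ = e≤
    cycᴱ-exp (false , _) _ = NP.≤-refl

  private
    exp-after-dec : ∀ t i → suc i ≤ m → mod3 (i + suc t) ≡ 0 → proj₂ (envelope (suc t) i) ≤ suc (hexp (suc i))
    exp-after-dec t i i<m r with Settled? (suc t) i
    ... | yes settled rewrite envelope-settled t i settled = z≤n
    ... | no unsettled rewrite envelope-unsettled t i unsettled | r = NP.≤-reflexive (hexp-suc (NP.<⇒≤ i<m))

    exp-after-min : ∀ t i → mod3 (i + suc (suc t)) ≡ 1 → proj₂ (envelope (suc (suc t)) i) ≤ suc (hexp i)
    exp-after-min t i r with Settled? (suc (suc t)) i
    ... | yes settled rewrite envelope-settled (suc t) i settled = z≤n
    ... | no unsettled rewrite envelope-unsettled (suc t) i unsettled | r =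
      NP.≤-trans (NP.∸-monoʳ-≤ (suc m) (NP.m≤m+n i t)) (NP.n≤1+n _)

    flag-after-dec : ∀ t i → mod3 (i + suc t) ≡ 0 → Flagged (suc t) i → proj₁ (envelope (suc t) i) ≡ true
    flag-after-dec t i r flagged with Settled? (suc t) i
    ... | yes settled rewrite envelope-settled t i settled = refl
    ... | no unsettled rewrite envelope-unsettled t i unsettled | r | ≤⇒≤ᵇ-true flagged = refl

    ∨-trueˡ : ∀ {a} b → a ≡ true → a ∨ b ≡ true
    ∨-trueˡ _ refl = refl

    ∧-true : ∀ {a b} → a ≡ true → b ≡ true → a ∧ b ≡ true
    ∧-true refl refl = refl

    ⊔ᴱ-exp≤ : ∀ t i → suc i ≤ m → mod3 (suc i + suc (suc t)) ≡ 1 →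
      proj₂ (envelope (suc (suc t)) i ⊔ᴱ envelope (suc (suc t)) (suc i)) ≤ suc (hexp (suc i))
    ⊔ᴱ-exp≤ t i i<m r = NP.⊔-lub (exp-after-dec (suc t) i i<m (mod3-suc≡1 (i + suc (suc t)) r)) (exp-after-min t (suc i) r)

  ⊔ᴱ-⊑ : ∀ t {i} → 1 ≤ i → suc i ≤ m → mod3 (suc i + t) ≡ 1 →
    envelope t i ⊔ᴱ envelope t (suc i) ⊑ envelope (suc t) (suc i)
  ⊔ᴱ-⊑ t {i} 1≤i i<m r with Settled? (suc t) (suc i)
  ⊔ᴱ-⊑ zero {i} 1≤i i<m r | yes settled = ⊥-elim (¬Settled₁ {suc i} (s≤s z≤n) settled)
  ⊔ᴱ-⊑ (suc t) {i} 1≤i i<m r | yes settled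
    rewrite envelope-settled (suc t) (suc i) settled | envelope-settled t i (Settled-pred {suc t} {i} settled)
    with Settled? (suc t) (suc i)
  ... | yes settled' rewrite envelope-settled t (suc i) settled' = ⊑-refl
  ... | no unsettled with () ← trans (sym (settling-residue {suc t} {suc i} settled unsettled)) r
  ⊔ᴱ-⊑ t {i} 1≤i i<m r | no unsettled
    rewrite envelope-unsettled t (suc i) unsettled | mod3-+suc-≡ (suc i) t r
    with 2 * suc i ≤? suc t + 1
  ⊔ᴱ-⊑ t {suc i} 1≤i i<m r | no _ | yes flagged rewrite slot₂-flagged t (suc (suc i)) flagged = flagged-case t r flagged
    where
    flagged-case : ∀ t → mod3 (suc (suc i) + t) ≡ 1 → Flagged (suc t) (suc (suc i)) →
      envelope t (suc i) ⊔ᴱ envelope t (suc (suc i)) ⊑ (true , suc (hexp (suc (suc i))))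
    flagged-case zero _ flagged = ⊥-elim (Flagged⇒late {0} {i} flagged (s≤s z≤n))
    flagged-case (suc zero) _ flagged = ⊥-elim (Flagged⇒late {1} {i} flagged (s≤s (s≤s z≤n)))
    flagged-case (suc (suc t)) r flagged =
      (λ _ → ∨-trueˡ _ (flag-after-dec (suc t) (suc i) (mod3-suc≡1 (suc i + suc (suc t)) r)
                                       (Flagged-pred {suc (suc t)} {suc i} flagged))) ,
      ⊔ᴱ-exp≤ t (suc i) i<m r
  ⊔ᴱ-⊑ t {i} 1≤i i<m r | no _ | no unflagged with suc t ≤? 2
  ... | yes early rewrite slot₂-early t (suc i) unflagged early =
    ⊑⊤ᴱ (NP.⊔-lub (envelope-exp≤ t 1≤i) (envelope-exp≤ t (s≤s z≤n)))
  ... | no late rewrite slot₂-late t (suc i) late | ≰⇒≤ᵇ-false unflagged = late-case t late r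
    where
    late-case : ∀ t → ¬ suc t ≤ 2 → mod3 (suc i + t) ≡ 1 →
      envelope t i ⊔ᴱ envelope t (suc i) ⊑ (false , suc (hexp (suc i)))
    late-case zero late _ = ⊥-elim (late (s≤s z≤n))
    late-case (suc zero) late _ = ⊥-elim (late (s≤s (s≤s z≤n)))
    late-case (suc (suc t)) _ r = (λ ()) , ⊔ᴱ-exp≤ t i i<m r

  private
    ⊓ᴱ-settles : ∀ t i → 1 ≤ i → mod3 (i + suc t) ≡ 0 → Settled (suc (suc t)) i →
      envelope (suc t) i ⊓ᴱ envelope (suc t) (suc i) ⊑ (true , 0)
    ⊓ᴱ-settles t i 1≤i r settled with Settled? (suc t) i
    ⊓ᴱ-settles zero i 1≤i r settled | yes settled' = ⊥-elim (¬Settled₁ 1≤i settled')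
    ⊓ᴱ-settles (suc t) i 1≤i r settled | yes settled' rewrite envelope-settled (suc t) i settled'
      with Settled? (suc (suc t)) (suc i)
    ... | yes settled₂ rewrite envelope-settled (suc t) (suc i) settled₂ = ⊑-refl
    ... | no unsettled₂ rewrite envelope-unsettled (suc t) (suc i) unsettled₂ | mod3-suc-≡ (i + suc (suc t)) r
                              | ≤⇒≤ᵇ-true (Settled⇒3m≤ {i} {t} 1≤i (NP.≤-trans settled' (NP.n≤1+n _))) = ⊑-refl
    ⊓ᴱ-settles t i 1≤i r settled | no unsettled
      rewrite envelope-unsettled t i unsettled | r | ≤⇒≤ᵇ-true (Settled⇒Flagged {suc t} {i} settled)
      with Settled? (suc t) (suc i)
    ... | yes settled₂ = ⊥-elim (unsettled (NP.≤-trans (Settled-pred {t} {i} settled₂) (NP.n≤1+n _)))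
    ... | no unsettled₂ rewrite envelope-unsettled t (suc i) unsettled₂ | mod3-suc-≡ (i + suc t) r =
      settling t unsettled settled
      where
      settling : ∀ t → ¬ Settled (suc t) i → Settled (suc (suc t)) i → (true , hexp i) ⊓ᴱ slot 1 t (suc i) ⊑ (true , 0)
      settling zero _ settled = ⊥-elim (¬Settled-early 1≤i (s≤s (s≤s z≤n)) settled)
      settling (suc t) unsettled settled
        rewrite ≤⇒≤ᵇ-true (Settled⇒3m≤ {i} {t} 1≤i settled)
              | NP.m≤n⇒m∸n≡0 (settling-exponent {i} {t} 1≤i (≤∧≰⇒≡ settled unsettled))
              | NP.⊓-zeroʳ (hexp i) = ⊑-refl

    flag-after-min : ∀ t i → i < m → mod3 (suc i + suc t) ≡ 1 → 3 * m ≤ i + suc (suc t) →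
      proj₁ (envelope (suc t) (suc i)) ≡ true
    flag-after-min zero i i<m r 3m≤ = ⊥-elim (¬3m≤i+2 i<m 3m≤)
    flag-after-min (suc t) i i<m r 3m≤ with Settled? (suc (suc t)) (suc i)
    ... | yes settled rewrite envelope-settled (suc t) (suc i) settled = refl
    ... | no unsettled rewrite envelope-unsettled (suc t) (suc i) unsettled | r
                            | ≤⇒≤ᵇ-true (subst (3 * m ≤_) (NP.+-suc i (suc (suc t))) 3m≤) = refl

    ⊓ᴱ-exp≤ : ∀ t i → mod3 (i + suc t) ≡ 0 → 1 ≤ i →
      proj₂ (envelope (suc t) i ⊓ᴱ envelope (suc t) (suc i)) ≤ suc m ∸ (i + t)
    ⊓ᴱ-exp≤ zero i r 1≤i rewrite envelope-unsettled 0 i (¬Settled₁ 1≤i) | r | NP.+-identityʳ i = NP.m⊓n≤m (hexp i) _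
    ⊓ᴱ-exp≤ (suc t) i r 1≤i = NP.≤-trans (NP.m⊓n≤n (proj₂ (envelope (suc (suc t)) i)) _) upper
      where
      upper : proj₂ (envelope (suc (suc t)) (suc i)) ≤ suc m ∸ (i + suc t)
      upper with Settled? (suc (suc t)) (suc i)
      ... | yes settled rewrite envelope-settled (suc t) (suc i) settled = z≤n
      ... | no unsettled rewrite envelope-unsettled (suc t) (suc i) unsettled | mod3-suc-≡ (i + suc (suc t)) r =
        NP.≤-reflexive (cong (suc m ∸_) (sym (NP.+-suc i t)))

  ⊓ᴱ-⊑ : ∀ t {i} → 1 ≤ i → i < m → mod3 (i + t) ≡ 0 → envelope t i ⊓ᴱ envelope t (suc i) ⊑ envelope (suc t) i
  ⊓ᴱ-⊑ t {i} 1≤i i<m r with Settled? (suc t) i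
  ⊓ᴱ-⊑ zero 1≤i i<m r | yes settled = ⊥-elim (¬Settled₁ 1≤i settled)
  ⊓ᴱ-⊑ (suc t) {i} 1≤i i<m r | yes settled rewrite envelope-settled (suc t) i settled = ⊓ᴱ-settles t i 1≤i r settled
  ⊓ᴱ-⊑ zero {i} 1≤i i<m r | no unsettled rewrite envelope-unsettled zero i unsettled | mod3-+suc-≡ i zero r =
    ⊑⊤ᴱ (NP.m⊓n≤m (suc m) (suc m))
  ⊓ᴱ-⊑ (suc t) {i} 1≤i i<m r | no unsettled rewrite envelope-unsettled (suc t) i unsettled | mod3-+suc-≡ i (suc t) r =
    (λ flagged → ∧-true (flag-after-dec t i r (3m≤⇒Flagged {i} {suc t} (NP.<⇒≤ i<m) (≤ᵇ-true⇒≤ flagged)))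
                        (flag-after-min t i i<m (mod3-suc-≡ (i + suc t) r) (≤ᵇ-true⇒≤ flagged))) ,
    ⊓ᴱ-exp≤ t i r 1≤i

module Convergence (m' : ℕ) where

  open import Defs
  open Residues
  open Families
  open Envelopes
  open Halves
  open Positions m'
  open Schedule m' hiding (m)
  open import Data.Nat as ℕ using (zero; suc; _∸_; z≤n; s≤s; _≤_; _<_)
  import Data.Nat.Properties as NP
  open import Data.Nat.Tactic.RingSolver using (solve-∀)
  open import Data.Integer as ℤ using (ℤ; +_; _+_; _-_; _⊓_; _⊔_)
  import Data.Integer.Properties as ZP
  open import Data.Bool using (true)
  open import Data.Product using (_×_; _,_; proj₁; proj₂)
  open import Data.Sum using (inj₁; inj₂)
  open import Relation.Binary.PropositionalEquality

  private
    1+n≢n : ∀ n → suc n ≢ n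
    1+n≢n n e = NP.<-irrefl (sym e) (NP.n<1+n n)

  dec-at-lower : ∀ x i → dec k i x i ≡ x i ⊓ (x (B ∸ i ℕ.+ 1) + h k i)
  dec-at-lower x i rewrite ≡ᵇ-refl i = refl

  dec-at-mirror : ∀ x {i} → i ≤ m → dec k i x (mirror i) ≡ (x i - h k i) ⊔ x (B ∸ i ℕ.+ 1)
  dec-at-mirror x {i} i≤m
    rewrite ≢⇒≡ᵇ-false (mirror≢ i≤m i≤m) | ≡⇒≡ᵇ-true (sym (B∸+1≡mirror i)) = refl

  mov-at-lower : ∀ x i → mov k i x i ≡ x i ⊓ x (suc i)
  mov-at-lower x i rewrite ≡ᵇ-refl i = refl

  mov-at-suc : ∀ x {i} → suc i ≤ m → mov k i x (suc i) ≡ x i ⊔ x (suc i)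
  mov-at-suc x {i} i<m
    rewrite ≢⇒≡ᵇ-false (1+n≢n i) | ≢⇒≡ᵇ-false (λ e → mirror≢ i<m i<m (trans (mirror-suc-<m i<m) (sym e)))
          | ≡ᵇ-refl (suc i) = refl

  mov-at-B∸ : ∀ x {i} → suc i ≤ m → mov k i x (B ∸ i) ≡ x (B ∸ i) ⊓ x (suc (B ∸ i))
  mov-at-B∸ x {i} i<m
    rewrite ≢⇒≡ᵇ-false (λ e → mirror≢ i<m (NP.<⇒≤ i<m) (trans (mirror-suc-<m i<m) e)) | ≡ᵇ-refl (B ∸ i) = refl

  mov-at-mirror : ∀ x {i} → suc i ≤ m → mov k i x (mirror i) ≡ x (B ∸ i) ⊔ x (suc (B ∸ i))
  mov-at-mirror x {i} i<m
    rewrite ≢⇒≡ᵇ-false (mirror≢ (NP.<⇒≤ i<m) (NP.<⇒≤ i<m)) | ≢⇒≡ᵇ-false (1+n≢n (B ∸ i))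
          | ≢⇒≡ᵇ-false (mirror≢ (NP.<⇒≤ i<m) i<m) | ≡ᵇ-refl (suc (B ∸ i)) = refl

  mov-at-1+m : ∀ x → mov k m x (suc m) ≡ x m ⊔ x (suc m)
  mov-at-1+m x
    rewrite ≢⇒≡ᵇ-false (1+n≢n m) | ≢⇒≡ᵇ-false (λ e → 1+n≢n m (trans e B∸m≡m)) | ≡ᵇ-refl (suc m) = refl

  cyc-at-B : ∀ x → cyc k x B ≡ (x 1 + + 1) ⊓ x B
  cyc-at-B x rewrite ≢⇒≡ᵇ-false (λ e → NP.<⇒≢ (NP.≤-<-trans (s≤s z≤n) m<B) (sym e)) | ≡ᵇ-refl B = refl

  h≡mersenne-hexp : ∀ i → h k i ≡ mersenne (hexp i)
  h≡mersenne-hexp zero = refl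
  h≡mersenne-hexp (suc i) = cong mersenne (trans (NP.∸-+-assoc (suc m) i 1) (cong (suc m ∸_) (NP.+-comm i 1)))

  R : ℤ
  R = mersenne (suc m)

  Invariant : ℤ → ℕ → Seq → Set
  Invariant s t x = ∀ i → 1 ≤ i → i ≤ m → Pair R s (envelope t i) (x i) (x (mirror i))

  round : ℕ → Seq → Seq
  round t = Q k (suc (mod3 t))

  private
    pair-step : ∀ {s A a b} T (y : Seq) i → y i ≡ a → y (mirror i) ≡ b → A ⊑ envelope T i →
      Pair R s A a b → Pair R s (envelope T i) (y i) (y (mirror i))
    pair-step T y i refl refl A⊑ (pair sum w) = pair sum (within-⊑ A⊑ w)

  module _ {s t x} (inv : Invariant s t x) where
    private
      y : Seq
      y = round t x

    dec-round : ∀ {i} → 1 ≤ i → i ≤ m → mod3 (i ℕ.+ t) ≡ 2 → Pair R s (envelope (suc t) i) (y i) (y (mirror i))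
    dec-round {i} 1≤i i≤m e = pair-step (suc t) y i at-lower at-mirror (decᴱ-⊑ t 1≤i e) (dec-pair (hexp i) (inv i 1≤i i≤m))
      where
      at-lower : y i ≡ x i ⊓ (x (mirror i) + mersenne (hexp i))
      at-lower = trans (Q-at-lower t x 1≤i i≤m e)
        (trans (dec-at-lower x i) (cong₂ (λ u v → x i ⊓ (x u + v)) (B∸+1≡mirror i) (h≡mersenne-hexp i)))
      at-mirror : y (mirror i) ≡ (x i - mersenne (hexp i)) ⊔ x (mirror i)
      at-mirror = trans (Q-at-mirror t x 1≤i i≤m e)
        (trans (dec-at-mirror x i≤m) (cong₂ (λ u v → (x i - v) ⊔ x u) (B∸+1≡mirror i) (h≡mersenne-hexp i)))

    min-round : ∀ {i} → 1 ≤ i → i < m → mod3 (i ℕ.+ t) ≡ 0 → Pair R s (envelope (suc t) i) (y i) (y (mirror i))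
    min-round {i} 1≤i i<m e =
      pair-step (suc t) y i at-lower at-mirror (⊓ᴱ-⊑ t 1≤i i<m e) (min-pairs (inv i 1≤i (NP.<⇒≤ i<m)) (inv (suc i) (s≤s z≤n) i<m))
      where
      at-lower : y i ≡ x i ⊓ x (suc i)
      at-lower = trans (Q-at-lower t x 1≤i (NP.<⇒≤ i<m) e) (mov-at-lower x i)
      at-mirror : y (mirror i) ≡ x (mirror (suc i)) ⊔ x (mirror i)
      at-mirror = trans (Q-at-mirror t x 1≤i (NP.<⇒≤ i<m) e)
        (trans (mov-at-mirror x i<m) (cong (λ u → x u ⊔ x (mirror i)) (sym (mirror-suc-<m i<m))))

    sort-round : mod3 (m ℕ.+ t) ≡ 0 → Pair R s (envelope (suc t) m) (y m) (y (mirror m))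
    sort-round e = pair-step (suc t) y m at-lower at-mirror (sortᴱ-⊑ t e) (sort-pair (inv m (s≤s z≤n) NP.≤-refl))
      where
      at-lower : y m ≡ x m ⊓ x (mirror m)
      at-lower = trans (Q-at-lower t x (s≤s z≤n) NP.≤-refl e) (trans (mov-at-lower x m) (cong (λ u → x m ⊓ x u) (sym mirror-m)))
      at-mirror : y (mirror m) ≡ x m ⊔ x (mirror m)
      at-mirror = trans (Q-at-mirror t x (s≤s z≤n) NP.≤-refl e)
        (trans (cong (mov k m x) mirror-m) (trans (mov-at-1+m x) (cong (λ u → x m ⊔ x u) (sym mirror-m))))

    cyc-round : mod3 (1 ℕ.+ t) ≡ 1 → Pair R s (envelope (suc t) 1) (y 1) (y (mirror 1))
    cyc-round e =
      pair-step (suc t) y 1 (Q-at-lower t x (s≤s z≤n) (s≤s z≤n) e) (trans (Q-at-mirror t x (s≤s z≤n) (s≤s z≤n) e) (cyc-at-B x))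
        (cycᴱ-⊑ t e) (cyc-pair (suc m) refl (inv 1 (s≤s z≤n) (s≤s z≤n)))

    max-round : ∀ {i} → 1 ≤ i → i < m → mod3 (suc i ℕ.+ t) ≡ 1 →
      Pair R s (envelope (suc t) (suc i)) (y (suc i)) (y (mirror (suc i)))
    max-round {i} 1≤i i<m e =
      pair-step (suc t) y (suc i) at-lower at-mirror (⊔ᴱ-⊑ t 1≤i i<m e)
        (max-pairs (inv i 1≤i (NP.<⇒≤ i<m)) (inv (suc i) (s≤s z≤n) i<m))
      where
      at-lower : y (suc i) ≡ x i ⊔ x (suc i)
      at-lower = trans (Q-at-lower t x (s≤s z≤n) i<m e) (trans (cong (λ o → Op.app o x (suc i)) (opFor-1 1≤i)) (mov-at-suc x i<m))
      at-mirror : y (mirror (suc i)) ≡ x (mirror (suc i)) ⊓ x (mirror i)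
      at-mirror = trans (Q-at-mirror t x (s≤s z≤n) i<m e)
        (trans (cong (Op.app (opFor 1 (suc i)) x) (mirror-suc-<m i<m))
        (trans (cong (λ o → Op.app o x (B ∸ i)) (opFor-1 1≤i))
        (trans (mov-at-B∸ x i<m) (cong (λ u → x u ⊓ x (mirror i)) (sym (mirror-suc-<m i<m))))))

  invariant-step : ∀ {s t x} → Invariant s t x → Invariant s (suc t) (round t x)
  invariant-step {s} {t} {x} inv i 1≤i i≤m with mod3 (i ℕ.+ t) in e | residue (i ℕ.+ t)
  ... | .2 | 2₃ = dec-round {s} {t} {x} inv 1≤i i≤m e
  ... | .0 | 0₃ with NP.m≤n⇒m<n∨m≡n i≤m
  ...   | inj₁ i<m = min-round {s} {t} {x} inv 1≤i i<m e
  ...   | inj₂ refl = sort-round {s} {t} {x} inv e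
  invariant-step {s} {t} {x} inv (suc zero) _ _ | .1 | 1₃ = cyc-round {s} {t} {x} inv e
  invariant-step {s} {t} {x} inv (suc (suc j)) _ i≤m | .1 | 1₃ = max-round {s} {t} {x} inv (s≤s z≤n) i≤m e

  rounds : Seq → ℕ → Seq
  rounds c zero = c
  rounds c (suc t) = round t (rounds c t)

  invariant-rounds : ∀ {s c} → Invariant s 0 c → ∀ t → Invariant s t (rounds c t)
  invariant-rounds inv zero = inv
  invariant-rounds inv (suc t) = invariant-step (invariant-rounds inv t)

  steps≡rounds : ∀ c n t → steps k (suc t) n (rounds c t) ≡ rounds c (t ℕ.+ n)
  steps≡rounds c zero t = cong (rounds c) (sym (NP.+-identityʳ t))
  steps≡rounds c (suc n) t = begin
    steps k (suc (suc t)) n (Q k ((t ℕ.% 3) ℕ.+ 1) (rounds c t))  ≡⟨ cong (λ r → steps k (suc (suc t)) n (Q k r (rounds c t))) family ⟩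
    steps k (suc (suc t)) n (rounds c (suc t))                    ≡⟨ steps≡rounds c n (suc t) ⟩
    rounds c (suc t ℕ.+ n)                                        ≡⟨ cong (rounds c) (sym (NP.+-suc t n)) ⟩
    rounds c (t ℕ.+ suc n)                                        ∎
    where
    open ≡-Reasoning
    family : (t ℕ.% 3) ℕ.+ 1 ≡ suc (mod3 t)
    family = trans (cong (ℕ._+ 1) (%3≡mod3 t)) (NP.+-comm (mod3 t) 1)

  N : ℕ
  N = suc (suc (suc (5 ℕ.* m')))

  F≡rounds : ∀ c → F k c ≡ rounds c N
  F≡rounds c = trans (cong (λ n → steps k 1 n c) rounds-count) (steps≡rounds c N 0)
    where
    rounds-count : 5 ℕ.* k ∸ 12 ≡ N
    rounds-count = trans (cong (_∸ 12) (expand m')) (NP.m+n∸m≡n 12 _)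
      where expand : ∀ m' → 5 ℕ.* suc (suc (suc m')) ≡ 12 ℕ.+ suc (suc (suc (5 ℕ.* m')))
            expand = solve-∀

  Bounded : Seq → Set
  Bounded c = ∀ t → 1 ≤ t → t ≤ B → + 0 ℤ.≤ c t × c t ℤ.≤ R

  private
    within-⊤ᴱ : ∀ {a b} → + 0 ℤ.≤ a → a ℤ.≤ R → + 0 ℤ.≤ b → b ℤ.≤ R → Within R ⊤ᴱ (a - b)
    within-⊤ᴱ {a} {b} 0≤a a≤R 0≤b b≤R = within -R≤a-b a-b≤R a-b≤R (λ ())
      where
      -R≤a-b : ℤ.- R ℤ.≤ a - b
      -R≤a-b = subst (ℤ._≤ a - b) (ZP.+-identityˡ (ℤ.- R)) (ZP.+-mono-≤ 0≤a (ZP.neg-mono-≤ b≤R))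
      a-b≤R : a - b ℤ.≤ R
      a-b≤R = subst (a - b ℤ.≤_) (ZP.+-identityʳ R) (ZP.+-mono-≤ a≤R (ZP.neg-mono-≤ 0≤b))

  invariant-initial : ∀ c → Bounded c → Balanced m c → Invariant (height m c) 0 c
  invariant-initial c bounded balanced i 1≤i i≤m with 0≤cᵢ , cᵢ≤R ← bounded i 1≤i (NP.≤-trans i≤m m≤B)
                                                with 0≤cⱼ , cⱼ≤R ← bounded (mirror i) (s≤s z≤n) (mirror-≤B 1≤i) =
    pair (mirror-sum i 1≤i i≤m) (within-⊤ᴱ 0≤cᵢ cᵢ≤R 0≤cⱼ cⱼ≤R)
    where
    mirror-sum : ∀ i → 1 ≤ i → i ≤ m → c i + c (mirror i) ≡ height m c
    mirror-sum (suc zero) _ _ = refl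
    mirror-sum (suc (suc j)) _ i≤m =
      trans (cong (λ p → c (suc (suc j)) + c p) (sym (B∸+1≡mirror (suc (suc j))))) (balanced (suc (suc j)) (s≤s (s≤s z≤n)) i≤m)

  private
    final-pair : ∀ c → Bounded c → Balanced m c → ∀ i → 1 ≤ i → i ≤ m →
      (∀ q → height m c ≡ + 2 ℤ.* q → rounds c N i ≡ q × rounds c N (mirror i) ≡ q) ×
      (∀ q → height m c ≡ + 2 ℤ.* q + + 1 → rounds c N i ≡ q × rounds c N (mirror i) ≡ q + + 1)
    final-pair c bounded balanced i 1≤i i≤m =
      pair-from-sum _ _ _ (Pair.sum≡ settled) (flag-bound w refl) (exponent-bound w)
      where
      settled : Pair R (height m c) (envelope N i) (rounds c N i) (rounds c N (mirror i))
      settled = invariant-rounds (invariant-initial c bounded balanced) N i 1≤i i≤m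
      w : Within R (true , 0) (rounds c N i - rounds c N (mirror i))
      w = subst (λ A → Within R A (rounds c N i - rounds c N (mirror i))) (envelope-final i≤m) (Pair.within-diff settled)

  sorted : ∀ c → Bounded c → Balanced m c →
    ((q : ℤ) → height m c ≡ + 2 ℤ.* q → ∀ t → 1 ≤ t → t ≤ B → F k c t ≡ q) ×
    ((q : ℤ) → height m c ≡ + 2 ℤ.* q + + 1 →
      (∀ t → 1 ≤ t → t ≤ m → F k c t ≡ q) × (∀ t → m < t → t ≤ B → F k c t ≡ q + + 1))
  sorted c bounded balanced = even , λ q s≡ → odd-lower q s≡ , odd-upper q s≡
    where
    x : Seq
    x = rounds c N
    F-at : ∀ {t u} → t ≡ u → F k c t ≡ x u
    F-at {t} refl = cong (λ f → f t) (F≡rounds c)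
    even : (q : ℤ) → height m c ≡ + 2 ℤ.* q → ∀ t → 1 ≤ t → t ≤ B → F k c t ≡ q
    even q s≡ t 1≤t t≤B with 1≤l , l≤m , side ← lower-range 1≤t t≤B with side
    ... | inj₁ t≡l = trans (F-at t≡l) (proj₁ (proj₁ (final-pair c bounded balanced _ 1≤l l≤m) q s≡))
    ... | inj₂ t≡l' = trans (F-at t≡l') (proj₂ (proj₁ (final-pair c bounded balanced _ 1≤l l≤m) q s≡))
    odd-lower : (q : ℤ) → height m c ≡ + 2 ℤ.* q + + 1 → ∀ t → 1 ≤ t → t ≤ m → F k c t ≡ q
    odd-lower q s≡ t 1≤t t≤m = trans (F-at refl) (proj₁ (proj₂ (final-pair c bounded balanced t 1≤t t≤m) q s≡))
    odd-upper : (q : ℤ) → height m c ≡ + 2 ℤ.* q + + 1 → ∀ t → m < t → t ≤ B → F k c t ≡ q + + 1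
    odd-upper q s≡ t m<t t≤B =
      trans (F-at (sym (mirror-mirror 1≤t t≤B)))
            (proj₂ (proj₂ (final-pair c bounded balanced (mirror t) (s≤s z≤n) (mirror≤m m<t)) q s≡))
      where
      1≤t : 1 ≤ t
      1≤t = NP.≤-trans (s≤s z≤n) m<t

open import Defs
open import Data.Nat as ℕ using (ℕ; _∸_; _^_)
open import Data.Integer as ℤ using (ℤ; +_)
open import Data.Product using (_×_)
open import Relation.Binary.PropositionalEquality using (_≡_)

lemma8 : (k : ℕ) → 3 ℕ.≤ k → (c : Seq) →
    (∀ t → 1 ℕ.≤ t → t ℕ.≤ b k → (+ 0 ℤ.≤ c t) × (c t ℤ.≤ + (2 ^ (k ∸ 1)) ℤ.- + 1)) →
    TwoFlat (k ∸ 2) c → Balanced (k ∸ 2) c →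
    ((q : ℤ) → height (k ∸ 2) c ≡ + 2 ℤ.* q →
      ∀ t → 1 ℕ.≤ t → t ℕ.≤ b k → F k c t ≡ q) ×
    ((q : ℤ) → height (k ∸ 2) c ≡ + 2 ℤ.* q ℤ.+ + 1 →
      (∀ t → 1 ℕ.≤ t → t ℕ.≤ k ∸ 2 → F k c t ≡ q) ×
      (∀ t → k ∸ 2 ℕ.< t → t ℕ.≤ b k → F k c t ≡ q ℤ.+ + 1))
lemma8 ℕ.zero () _ _ _ _
lemma8 (ℕ.suc ℕ.zero) (ℕ.s≤s ()) _ _ _ _
lemma8 (ℕ.suc (ℕ.suc ℕ.zero)) (ℕ.s≤s (ℕ.s≤s ())) _ _ _ _
lemma8 (ℕ.suc (ℕ.suc (ℕ.suc m'))) _ c bounded _ balanced = Convergence.sorted m' c bounded balanced
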